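{- Let $k$ be a positive integer, $a=12k+4$ and $S=\{a,\,a+\frac a2-3,\,a+\frac a2-1\}=\{12k+4,18k+3,18k+5\}$. Then $x\in\langle S\rangle$ if and only if $x=(s+q)a+q\cdot\frac a2-3q+2r$ for some $s,q,r\in\mathbb{N}$ with $0\le r\le q$; moreover $\langle S\rangle$ is a $3$-permutation numerical semigroup.
   Context: A numerical semigroup is a submonoid $G$ of $(\mathbb{N},+,0)$ with $\mathbb{N}\setminus G$ finite; $\langle S\rangle$ is the submonoid generated by $S$. Write the elements of $G$ as $0=g_0<g_1<g_2<\cdots$. For $n\ge 1$, $G$ is an $n$-permutation numerical semigroup if $G=\langle g_1,\dots,g_n\rangle$ and for every integer $k\ge 0$ the tuple $(g_{kn+1}\bmod n,\dots,g_{kn+n}\bmod n)$ contains exactly one representative of each residue class of $\mathbb{Z}/n\mathbb{Z}$. -}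

module Defs where

open import Data.Nat using (ℕ; zero; suc; _+_; _*_; _≤_; _<_; NonZero)
open import Data.Nat.DivMod using (_%_)
open import Data.List using (List; []; _∷_; map; upTo)
open import Data.List.Membership.Propositional using (_∈_)
open import Data.Product using (Σ; _×_; ∃)
open import Relation.Binary.PropositionalEquality using (_≡_)
open import Function.Bundles using (_⇔_)

data ⟨_⟩ (S : List ℕ) : ℕ → Set where
  gen-zero : ⟨ S ⟩ 0
  gen-add  : ∀ {x s} → s ∈ S → ⟨ S ⟩ x → ⟨ S ⟩ (s + x)

record IsNumericalSemigroup (G : ℕ → Set) : Set where
  field
    has-zero  : G 0
    closed-+  : ∀ {x y} → G x → G y → G (x + y)
    cofinite  : Σ ℕ λ N → ∀ x → N ≤ x → G x

record IsEnumeration (G : ℕ → Set) (g : ℕ → ℕ) : Set where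
  field
    strictly-increasing : ∀ i → g i < g (suc i)
    members             : ∀ i → G (g i)
    exhaustive          : ∀ x → G x → Σ ℕ λ i → g i ≡ x

record IsPermutationNS (n : ℕ) .{{_ : NonZero n}} (G : ℕ → Set) : Set where
  field
    numerical   : IsNumericalSemigroup G
    g           : ℕ → ℕ
    enumeration : IsEnumeration G g
    generated   : ∀ x → G x ⇔ ⟨ map (λ i → g (suc i)) (upTo n) ⟩ x
    residues    : ∀ k r → r < n →
                  Σ ℕ λ i → i < n × g (k * n + suc i) % n ≡ r ×
                    (∀ j → j < n → g (k * n + suc j) % n ≡ r → j ≡ i)

-- With h = 6k + 2 the generators are 2h, 3h − 3 and 3h − 1, so every element is m h − t for a
-- level m and a defect t (see Defect).  Only the levels M + 1 and M + 2 reach into the window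
-- (M h, (M + 1) h], and the defects of a level run in steps of 2 down from a multiple of 3.
-- Weighting the residue classes mod 3 by ℤ³ modulo the diagonal, this yields a closed form for
-- the residue imbalance of the elements up to x, and a finite table shows that the imbalance
-- never leaves the hexagon "at most one class in excess or in deficit"; beyond the conductor
-- (12k + 3) h every number is an element.  A walk in the hexagon must return to 0 after each
-- three steps, using every residue once, so each block g₃ⱼ₊₁, g₃ⱼ₊₂, g₃ⱼ₊₃ is a permutation of
-- the residues; the first block consists of the generators.
module Submission where

open import Defs
open import Data.Nat
open import Data.Nat.Properties
open import Data.Nat.DivMod
open import Data.Nat.Tactic.RingSolver
open import Data.Bool using (Bool; true; false; if_then_else_; not; T)
open import Data.Unit using (tt)
open import Data.Integer as ℤ using (ℤ)
import Data.Integer.Properties as ℤ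
open import Data.List using (List; []; _∷_)
open import Data.List.Relation.Unary.Any using (here; there)
open import Data.List.Membership.Propositional using (_∈_)
open import Data.Product
open import Data.Sum using (_⊎_; inj₁; inj₂; [_,_]′)
open import Data.Empty using (⊥; ⊥-elim)
open import Function using (case_of_; _∋_; _∘_; id)
open import Function.Bundles using (_⇔_; mk⇔)
open import Relation.Nullary
open import Relation.Nullary.Decidable using (map′; _×-dec_; dec-true; dec-false; T?)
open import Relation.Binary.PropositionalEquality
open import Relation.Binary.Definitions using (tri<; tri≈; tri>)

indicator : ∀ {p} {P : Set p} → Dec P → ℕ
indicator (yes _) = 1
indicator (no _)  = 0

indicator-yes : ∀ {p} {P : Set p} (P? : Dec P) → P → indicator P? ≡ 1
indicator-yes (yes _) _ = refl
indicator-yes (no ¬p) p = ⊥-elim (¬p p)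

indicator-no : ∀ {p} {P : Set p} (P? : Dec P) → ¬ P → indicator P? ≡ 0
indicator-no (yes p) ¬p = ⊥-elim (¬p p)
indicator-no (no _) _ = refl

≤-from-+ : ∀ {x y} d → x + d ≡ y → x ≤ y
≤-from-+ {x} d refl = m≤m+n x d

≤-to-+ : ∀ {x y} → x ≤ y → Σ ℕ λ d → x + d ≡ y
≤-to-+ {x} {y} x≤y = y ∸ x , m+[n∸m]≡n x≤y

m+[2+n]≡m+[1+n]+1 : ∀ m n → m + suc (suc n) ≡ m + suc n + 1
m+[2+n]≡m+[1+n]+1 m n = solve (m ∷ n ∷ [])

m+[3+n]≡m+[1+n]+2 : ∀ m n → m + suc (suc (suc n)) ≡ m + suc n + 2
m+[3+n]≡m+[1+n]+2 m n = solve (m ∷ n ∷ [])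

%-cong-+ˡ : ∀ z {x y n} .{{_ : NonZero n}} → x % n ≡ y % n → (z + x) % n ≡ (z + y) % n
%-cong-+ˡ z {x} {y} {n} eq = begin
  (z + x) % n             ≡⟨ %-distribˡ-+ z x n ⟩
  (z % n + x % n) % n     ≡⟨ cong (λ v → (z % n + v) % n) eq ⟩
  (z % n + y % n) % n     ≡⟨ %-distribˡ-+ z y n ⟨
  (z + y) % n             ∎
  where open ≡-Reasoning

%-cong-+ʳ : ∀ z {x y n} .{{_ : NonZero n}} → x % n ≡ y % n → (x + z) % n ≡ (y + z) % n
%-cong-+ʳ z {x} {y} {n} eq = subst₂ (λ u v → u % n ≡ v % n) (+-comm z x) (+-comm z y) (%-cong-+ˡ z eq)

%-cancel-+ˡ : ∀ z {x y n} .{{_ : NonZero n}} → (z + x) % n ≡ (z + y) % n → x % n ≡ y % n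
%-cancel-+ˡ z {x} {y} {suc n} eq = begin
  x % suc n                   ≡⟨ [m+kn]%n≡m%n x z (suc n) ⟨
  (x + z * suc n) % suc n     ≡⟨ cong (_% suc n) (regroup x) ⟩
  (z + x + z * n) % suc n     ≡⟨ %-cong-+ʳ (z * n) {z + x} {z + y} eq ⟩
  (z + y + z * n) % suc n     ≡⟨ cong (_% suc n) (regroup y) ⟨
  (y + z * suc n) % suc n     ≡⟨ [m+kn]%n≡m%n y z (suc n) ⟩
  y % suc n                   ∎
  where
  open ≡-Reasoning
  regroup : ∀ v → v + z * suc n ≡ z + v + z * n
  regroup v = solve (v ∷ z ∷ n ∷ [])

even⇒¬even-suc : ∀ {n} → n % 2 ≡ 0 → ¬ (suc n % 2 ≡ 0)
even⇒¬even-suc {n} even even′ = case trans (sym even′) (%-cong-+ˡ 1 {n} {0} even) of λ ()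

¬even⇒even-suc : ∀ {n} → ¬ (n % 2 ≡ 0) → suc n % 2 ≡ 0
¬even⇒even-suc {n} odd with n % 2 in eq | m%n<n n 2
... | 0 | _ = ⊥-elim (odd refl)
... | 1 | _ = trans (%-cong-+ˡ 1 {n} {1} (trans eq refl)) refl
... | suc (suc _) | s≤s (s≤s ())

isEven : ℕ → Bool
isEven 0 = true
isEven 1 = false
isEven (suc (suc n)) = isEven n

isEven-suc : ∀ n → isEven (suc n) ≡ not (isEven n)
isEven-suc 0 = refl
isEven-suc 1 = refl
isEven-suc (suc (suc n)) = isEven-suc n

isEven⇒double : ∀ n → isEven n ≡ true → Σ ℕ λ j → n ≡ 2 * j
isEven⇒double 0 _ = 0 , refl
isEven⇒double (suc (suc n)) e with j , refl ← isEven⇒double n e = suc j , solve (j ∷ [])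

isEven-double : ∀ j {n} → n ≡ 2 * j → isEven n ≡ true
isEven-double zero refl = refl
isEven-double (suc j) refl = trans (cong isEven (2 * suc j ≡ 2 + 2 * j ∋ solve (j ∷ []))) (isEven-double j refl)

¬isEven⇒odd : ∀ n → isEven n ≡ false → Σ ℕ λ j → n ≡ 1 + 2 * j
¬isEven⇒odd 1 _ = 0 , refl
¬isEven⇒odd (suc (suc n)) e with j , refl ← ¬isEven⇒odd n e = suc j , solve (j ∷ [])

-- s · 2h + q · (3h − 3) + 2r = m h − t  for the level  m = 2s + 3q  and the
-- defect  t = 3q − 2r  (0 ≤ r ≤ q).
data Defect (m t : ℕ) : Set where
  defect : (s q r : ℕ) → r ≤ q → m ≡ 2 * s + 3 * q → t + 2 * r ≡ 3 * q → Defect m t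

defect? : ∀ m t → Dec (Defect m t)
defect? m t = map′ unpack pack (anyUpTo? (λ s → anyUpTo? (λ q → anyUpTo? (λ r →
    r ≤? q ×-dec m ≟ 2 * s + 3 * q ×-dec t + 2 * r ≟ 3 * q) (suc m)) (suc m)) (suc m))
  where
  Witness : Set
  Witness = ∃ λ s → s < suc m × ∃ λ q → q < suc m × ∃ λ r → r < suc m ×
              r ≤ q × m ≡ 2 * s + 3 * q × t + 2 * r ≡ 3 * q
  unpack : Witness → Defect m t
  unpack (s , _ , q , _ , r , _ , r≤q , m≡ , t≡) = defect s q r r≤q m≡ t≡
  pack : Defect m t → Witness
  pack (defect s q r r≤q m≡ t≡) =
    s , s≤s s≤m , q , s≤s q≤m , r , s≤s (≤-trans r≤q q≤m) , r≤q , m≡ , t≡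
    where
    s≤m : s ≤ m
    s≤m = subst (s ≤_) (sym m≡) (≤-from-+ (s + 3 * q) (solve (s ∷ q ∷ [])))
    q≤m : q ≤ m
    q≤m = subst (q ≤_) (sym m≡) (≤-from-+ (2 * s + 2 * q) (solve (s ∷ q ∷ [])))

defect⇒≤ : ∀ {m t} → Defect m t → t ≤ m
defect⇒≤ (defect s q r _ m≡ t≡) =
  ≤-trans (≤-from-+ (2 * r) t≡) (≤-from-+ (2 * s) (trans (+-comm (3 * q) (2 * s)) (sym m≡)))

defect⇒even : ∀ {m t} → Defect m t → (m + t) % 2 ≡ 0
defect⇒even {m} {t} (defect s q r _ m≡ t≡) = begin
  (m + t) % 2                 ≡⟨ [m+kn]%n≡m%n (m + t) r 2 ⟨
  (m + t + r * 2) % 2         ≡⟨ cong (_% 2) doubled ⟩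
  ((s + 3 * q) * 2) % 2       ≡⟨ m*n%n≡0 (s + 3 * q) 2 ⟩
  0                           ∎
  where
  open ≡-Reasoning
  doubled : m + t + r * 2 ≡ (s + 3 * q) * 2
  doubled = begin
    m + t + r * 2             ≡⟨ cong (λ v → v + t + r * 2) m≡ ⟩
    2 * s + 3 * q + t + r * 2 ≡⟨ solve (s ∷ q ∷ t ∷ r ∷ []) ⟩
    2 * s + 3 * q + (t + 2 * r) ≡⟨ cong (2 * s + 3 * q +_) t≡ ⟩
    2 * s + 3 * q + 3 * q     ≡⟨ solve (s ∷ q ∷ []) ⟩
    (s + 3 * q) * 2           ∎

defect⇒¬defect-suc : ∀ {m t} → Defect m t → ¬ Defect m (suc t)
defect⇒¬defect-suc {m} {t} d d′ =
  even⇒¬even-suc {m + t} (defect⇒even d) (trans (cong (_% 2) (sym (+-suc m t))) (defect⇒even d′))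

defect-lower : ∀ {m t} → Defect m (2 + t) → Defect m t
defect-lower {m} {t} (defect s q r r≤q m≡ t≡) with m≤n⇒m<n∨m≡n r≤q
... | inj₁ r<q = defect s q (suc r) r<q m≡ (t + 2 * suc r ≡⟨ solve (t ∷ r ∷ []) ⟩ t≡)
  where open ≡-Reasoning
... | inj₂ refl = trade q m≡ t≡
  where
  open ≡-Reasoning
  -- r = q: trading two generators 3h − 1 for three generators 2h adds 2.
  trade : ∀ q → m ≡ 2 * s + 3 * q → 2 + t + 2 * q ≡ 3 * q → Defect m t
  trade 0 _ ()
  trade 1 _ eq = case trans (+-comm 2 t) (suc-injective (suc-injective eq)) of λ ()
  trade (suc (suc q)) m≡ t≡ = defect (s + 3) q q ≤-refl
    (trans m≡ (solve (s ∷ q ∷ [])))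
    (+-cancelʳ-≡ 6 _ _ (t + 2 * q + 6 ≡⟨ solve (t ∷ q ∷ []) ⟩ trans t≡ (solve (q ∷ []))))

defect-descend : ∀ {m} v d → Defect m (v + d) → Defect m v ⊎ Defect m (suc v)
defect-descend v zero d = inj₁ (subst (Defect _) (+-identityʳ v) d)
defect-descend v (suc zero) d = inj₂ (subst (Defect _) (+-comm v 1) d)
defect-descend v (suc (suc e)) d =
  defect-descend v e (defect-lower (subst (Defect _) (trans (+-suc v (suc e)) (cong suc (+-suc v e))) d))

no-defect-from : ∀ {m τ} → ¬ Defect m τ → ¬ Defect m (suc τ) → ∀ t → τ ≤ t → ¬ Defect m t
no-defect-from {τ = τ} ¬d ¬d′ t τ≤t dt with ≤-to-+ τ≤t
... | e , refl = [ ¬d , ¬d′ ]′ (defect-descend τ e dt)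

defect-below-top : ∀ {m top u} → Defect m top → u ≤ top → (m + u) % 2 ≡ 0 → Defect m u
defect-below-top {m} {top} {u} d u≤top even with e , refl ← ≤-to-+ u≤top with defect-descend u e d
... | inj₁ d′ = d′
... | inj₂ d′ = ⊥-elim (even⇒¬even-suc {m + u} even (trans (cong (_% 2) (sym (+-suc m u))) (defect⇒even d′)))

top-defect%3≡0 : ∀ {m t} → Defect m t → ¬ Defect m (2 + t) → t % 3 ≡ 0
top-defect%3≡0 {t = t} (defect s q zero _ _ t≡) _ = begin
  t % 3                       ≡⟨ cong (_% 3) (trans (sym (+-identityʳ t)) t≡) ⟩
  (3 * q) % 3                 ≡⟨ cong (_% 3) (*-comm 3 q) ⟩
  (q * 3) % 3                 ≡⟨ m*n%n≡0 q 3 ⟩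
  0                           ∎
  where open ≡-Reasoning
top-defect%3≡0 {t = t} (defect s q (suc r) r<q m≡ t≡) ¬d =
  ⊥-elim (¬d (defect s q r (≤-trans (n≤1+n r) r<q) m≡ (2 + t + 2 * r ≡⟨ solve (t ∷ r ∷ []) ⟩ t≡)))
  where open ≡-Reasoning

level-pred-form : ∀ {m} s q → suc m ≡ 2 * s + 3 * suc q → m ≡ 2 * (s + 1) + 3 * q
level-pred-form s q m≡ = suc-injective (trans m≡ regroup)
  where
  regroup : 2 * s + 3 * suc q ≡ suc (2 * (s + 1) + 3 * q)
  regroup = solve (s ∷ q ∷ [])

defect-level-pred : ∀ {m t} → Defect (suc m) (3 + t) → Defect m t
defect-level-pred {t = t} (defect s zero r _ _ t≡) = case trans (sym (+-assoc 3 t (2 * r))) t≡ of λ ()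
defect-level-pred {m} {t} (defect s (suc q) zero _ m≡ t≡) =
  defect (s + 1) q 0 z≤n (level-pred-form s q m≡) (+-cancelˡ-≡ 3 _ _ (3 + (t + 2 * 0) ≡⟨ solve (t ∷ []) ⟩ trans t≡ (solve (q ∷ []))))
  where open ≡-Reasoning
defect-level-pred {m} {t} (defect s (suc q) (suc r) r<q m≡ t≡) =
  defect-lower (defect (s + 1) q r (≤-pred r<q) (level-pred-form s q m≡)
    (+-cancelˡ-≡ 3 _ _ (3 + (2 + t + 2 * r) ≡⟨ solve (t ∷ r ∷ []) ⟩ trans t≡ (solve (q ∷ [])))))
  where open ≡-Reasoning

¬defect-level1 : ∀ {t} → ¬ Defect 1 t
¬defect-level1 (defect zero zero _ _ () _)
¬defect-level1 (defect (suc s) zero _ _ m≡ _) =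
  case trans m≡ (2 * suc s + 3 * 0 ≡ 2 + 2 * s ∋ solve (s ∷ [])) of λ ()
¬defect-level1 (defect s (suc q) _ _ m≡ _) =
  case trans m≡ (2 * s + 3 * suc q ≡ 3 + (2 * s + 3 * q) ∋ solve (s ∷ q ∷ [])) of λ ()

defect-even-level : ∀ j → Defect (2 * j) 0
defect-even-level j = defect j 0 0 z≤n (sym (+-identityʳ (2 * j))) refl

defect-odd-level : ∀ j → Defect (3 + 2 * j) 1
defect-odd-level j = defect j 1 1 ≤-refl (+-comm 3 (2 * j)) refl

count-from : ∀ {P : ℕ → Set} → (∀ n → Dec (P n)) → (start length : ℕ) → ℕ
count-from P? start zero = 0
count-from P? start (suc n) = indicator (P? start) + count-from P? (suc start) n

count-from-none : ∀ {P : ℕ → Set} (P? : ∀ n → Dec (P n)) start n →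
                  (∀ i → start ≤ i → ¬ P i) → count-from P? start n ≡ 0
count-from-none P? start zero none = refl
count-from-none P? start (suc n) none with P? start
... | yes p = ⊥-elim (none start ≤-refl p)
... | no _ = count-from-none P? (suc start) n (λ i le → none i (≤-trans (n≤1+n start) le))

opaque
  #defects≥ : (m τ : ℕ) → ℕ
  #defects≥ m τ = count-from (defect? m) τ (suc m ∸ τ)

  #defects≥-step : ∀ m τ → #defects≥ m τ ≡ indicator (defect? m τ) + #defects≥ m (suc τ)
  #defects≥-step m τ with τ ≤? m
  ... | yes τ≤m = cong (count-from (defect? m) τ) (+-∸-assoc 1 τ≤m)
  ... | no τ≰m with defect? m τ
  ...   | yes d = ⊥-elim (τ≰m (defect⇒≤ d))
  ...   | no _ = trans (cong (count-from (defect? m) τ) (m≤n⇒m∸n≡0 (≰⇒> τ≰m)))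
                       (sym (cong (count-from (defect? m) (suc τ)) (m≤n⇒m∸n≡0 (<⇒≤ (≰⇒> τ≰m)))))

  #defects≥-none : ∀ {m τ} → (∀ t → τ ≤ t → ¬ Defect m t) → #defects≥ m τ ≡ 0
  #defects≥-none {m} {τ} = count-from-none (defect? m) τ (suc m ∸ τ)

#defects≥-yes : ∀ {m τ} → Defect m τ → #defects≥ m τ ≡ suc (#defects≥ m (suc τ))
#defects≥-yes {m} {τ} d =
  trans (#defects≥-step m τ) (cong (_+ #defects≥ m (suc τ)) (indicator-yes (defect? m τ) d))

#defects≥-no : ∀ {m τ} → ¬ Defect m τ → #defects≥ m τ ≡ #defects≥ m (suc τ)
#defects≥-no {m} {τ} ¬d =
  trans (#defects≥-step m τ) (cong (_+ #defects≥ m (suc τ)) (indicator-no (defect? m τ) ¬d))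

-- Above a defect t, the defects of level m are t, t + 2, …, up to a multiple of 3,
-- so there are (top − t) / 2 + 1 ≡ t + 1 (mod 3) of them.
#defects≥-of-defect : ∀ {m t} → Defect m t → #defects≥ m t % 3 ≡ suc t % 3
#defects≥-of-defect {m} {t} = go m (m≤m+n m t)
  where
  open ≡-Reasoning
  go : ∀ F {t} → m ≤ F + t → Defect m t → #defects≥ m t % 3 ≡ suc t % 3
  go F {t} m≤ d with defect? m (2 + t)
  ... | no ¬d₂ = begin
    #defects≥ m t % 3               ≡⟨ cong (_% 3) (#defects≥-yes d) ⟩
    suc (#defects≥ m (suc t)) % 3   ≡⟨ cong (λ n → suc n % 3) (#defects≥-none (no-defect-from
                                          (defect⇒¬defect-suc d) ¬d₂)) ⟩
    1                               ≡⟨ %-cong-+ˡ 1 {t} {0} (top-defect%3≡0 d ¬d₂) ⟨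
    suc t % 3                       ∎
  go zero {t} m≤ d | yes d₂ = ⊥-elim (<⇒≱ (≤-trans (n≤1+n (suc t)) (defect⇒≤ d₂)) m≤)
  go (suc F) {t} m≤ d | yes d₂ = begin
    #defects≥ m t % 3                     ≡⟨ cong (_% 3) (#defects≥-yes d) ⟩
    suc (#defects≥ m (suc t)) % 3         ≡⟨ cong (λ n → suc n % 3) (#defects≥-no (defect⇒¬defect-suc d)) ⟩
    suc (#defects≥ m (2 + t)) % 3         ≡⟨ %-cong-+ˡ 1 {#defects≥ m (2 + t)} {suc (2 + t)} (go F (≤-trans m≤ slack) d₂) ⟩
    (1 + suc (2 + t)) % 3                 ≡⟨ cong (_% 3) (+-comm 3 (suc t)) ⟩
    (suc t + 3) % 3                       ≡⟨ [m+n]%n≡m%n (suc t) 3 ⟩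
    suc t % 3                             ∎
    where
    slack : suc F + t ≤ F + (2 + t)
    slack = ≤-from-+ 1 (solve (F ∷ t ∷ []))

-- Residue weights.  ℤ² stands for ℤ³ modulo the diagonal: the residue classes 0, 1, 2
-- have weights (1,0), (0,1), (−1,−1), which sum to zero, so a multiset of residues has
-- weight 0 exactly when every class occurs equally often.
module Weights where
  open import Data.Integer using (+_; -[1+_])

  ℤ² : Set
  ℤ² = ℤ × ℤ

  0ℤ² : ℤ²
  0ℤ² = + 0 , + 0

  infixl 6 _⊕_
  _⊕_ : ℤ² → ℤ² → ℤ²
  (a , b) ⊕ (c , d) = a ℤ.+ c , b ℤ.+ d

  ⊕-assoc : ∀ x y z → (x ⊕ y) ⊕ z ≡ x ⊕ (y ⊕ z)
  ⊕-assoc (a , b) (c , d) (e , f) = cong₂ _,_ (ℤ.+-assoc a c e) (ℤ.+-assoc b d f)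

  ⊕-comm : ∀ x y → x ⊕ y ≡ y ⊕ x
  ⊕-comm (a , b) (c , d) = cong₂ _,_ (ℤ.+-comm a c) (ℤ.+-comm b d)

  ⊕-identityˡ : ∀ x → 0ℤ² ⊕ x ≡ x
  ⊕-identityˡ (a , b) = cong₂ _,_ (ℤ.+-identityˡ a) (ℤ.+-identityˡ b)

  ⊕-identityʳ : ∀ x → x ⊕ 0ℤ² ≡ x
  ⊕-identityʳ (a , b) = cong₂ _,_ (ℤ.+-identityʳ a) (ℤ.+-identityʳ b)

  residueWeight : ℕ → ℤ²
  residueWeight 0 = + 1 , + 0
  residueWeight 1 = + 0 , + 1
  residueWeight _ = -[1+ 0 ] , -[1+ 0 ]

  weight : ℕ → ℤ²
  weight n = residueWeight (n % 3)

  -- The hexagon 0, ± residueWeight r: at most one residue class in excess or in deficit.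
  isSmall : ℤ² → Bool
  isSmall (+ 0 , + 0) = true
  isSmall (+ 1 , + 0) = true
  isSmall (+ 0 , + 1) = true
  isSmall (-[1+ 0 ] , -[1+ 0 ]) = true
  isSmall (-[1+ 0 ] , + 0) = true
  isSmall (+ 0 , -[1+ 0 ]) = true
  isSmall (+ 1 , + 1) = true
  isSmall _ = false

  Small : ℤ² → Set
  Small e = T (isSmall e)

open Weights public

residue-cases : ∀ z → z % 3 ≡ 0 ⊎ z % 3 ≡ 1 ⊎ z % 3 ≡ 2
residue-cases z with z % 3 | m%n<n z 3
... | 0 | _ = inj₁ refl
... | 1 | _ = inj₂ (inj₁ refl)
... | 2 | _ = inj₂ (inj₂ refl)
... | suc (suc (suc _)) | s≤s (s≤s (s≤s ()))

weight-+ : ∀ z c → weight (z + c) ≡ residueWeight ((z % 3 + c % 3) % 3)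
weight-+ z c = cong residueWeight (%-distribˡ-+ z c 3)

weight-cong : ∀ x y → x % 3 ≡ y % 3 → weight x ≡ weight y
weight-cong _ _ = cong residueWeight

consecutive-weights≡0 : ∀ z → weight z ⊕ weight (z + 1) ⊕ weight (z + 2) ≡ 0ℤ²
consecutive-weights≡0 z rewrite weight-+ z 1 | weight-+ z 2 with residue-cases z
... | inj₁ e rewrite e = refl
... | inj₂ (inj₁ e) rewrite e = refl
... | inj₂ (inj₂ e) rewrite e = refl

step-2-weights≡0 : ∀ z → weight z ⊕ weight (z + 2) ⊕ weight (z + 4) ≡ 0ℤ²
step-2-weights≡0 z rewrite weight-+ z 2 | weight-+ z 4 with residue-cases z
... | inj₁ e rewrite e = refl
... | inj₂ (inj₁ e) rewrite e = refl
... | inj₂ (inj₂ e) rewrite e = refl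

small-one-weight : ∀ z → Small (0ℤ² ⊕ weight z)
small-one-weight z with residue-cases z
... | inj₁ e rewrite e = tt
... | inj₂ (inj₁ e) rewrite e = tt
... | inj₂ (inj₂ e) rewrite e = tt

small-two-weights : ∀ z → Small (0ℤ² ⊕ weight z ⊕ weight (z + 1))
small-two-weights z rewrite weight-+ z 1 with residue-cases z
... | inj₁ e rewrite e = tt
... | inj₂ (inj₁ e) rewrite e = tt
... | inj₂ (inj₂ e) rewrite e = tt

progressionWeight : (n c : ℕ) → ℤ²
progressionWeight zero c = 0ℤ²
progressionWeight (suc n) c = progressionWeight n c ⊕ weight (c + 2 * n)

progressionWeight-+3 : ∀ n c → progressionWeight (n + 3) c ≡ progressionWeight n c
progressionWeight-+3 n c = begin
  progressionWeight (n + 3) c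
    ≡⟨ cong (λ l → progressionWeight l c) (+-comm n 3) ⟩
  A ⊕ weight z ⊕ weight (c + 2 * suc n) ⊕ weight (c + 2 * suc (suc n))
    ≡⟨ cong₂ (λ u v → A ⊕ weight z ⊕ weight u ⊕ weight v)
             (c + 2 * suc n ≡ c + 2 * n + 2 ∋ solve (c ∷ n ∷ []))
             (c + 2 * suc (suc n) ≡ c + 2 * n + 4 ∋ solve (c ∷ n ∷ [])) ⟩
  A ⊕ weight z ⊕ weight (z + 2) ⊕ weight (z + 4)
    ≡⟨ ⊕-assoc (A ⊕ weight z) (weight (z + 2)) (weight (z + 4)) ⟩
  A ⊕ weight z ⊕ (weight (z + 2) ⊕ weight (z + 4))
    ≡⟨ ⊕-assoc A (weight z) (weight (z + 2) ⊕ weight (z + 4)) ⟩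
  A ⊕ (weight z ⊕ (weight (z + 2) ⊕ weight (z + 4)))
    ≡⟨ cong (A ⊕_) (trans (sym (⊕-assoc (weight z) (weight (z + 2)) (weight (z + 4)))) (step-2-weights≡0 z)) ⟩
  A ⊕ 0ℤ²
    ≡⟨ ⊕-identityʳ A ⟩
  A ∎
  where
  open ≡-Reasoning
  A = progressionWeight n c
  z = c + 2 * n

progressionWeight-%3ˡ : ∀ n c → progressionWeight n c ≡ progressionWeight (n % 3) c
progressionWeight-%3ˡ n c = trans (cong (λ l → progressionWeight l c) (m≡m%n+[m/n]*n n 3)) (periodic (n % 3) (n / 3))
  where
  open ≡-Reasoning
  periodic : ∀ r j → progressionWeight (r + j * 3) c ≡ progressionWeight r c
  periodic r zero = cong (λ l → progressionWeight l c) (+-identityʳ r)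
  periodic r (suc j) = begin
    progressionWeight (r + suc j * 3) c    ≡⟨ cong (λ l → progressionWeight l c) (solve (r ∷ j ∷ [])) ⟩
    progressionWeight (r + j * 3 + 3) c    ≡⟨ progressionWeight-+3 (r + j * 3) c ⟩
    progressionWeight (r + j * 3) c        ≡⟨ periodic r j ⟩
    progressionWeight r c                  ∎

progressionWeight-%3ʳ : ∀ n c → progressionWeight n c ≡ progressionWeight n (c % 3)
progressionWeight-%3ʳ zero c = refl
progressionWeight-%3ʳ (suc n) c = cong₂ _⊕_ (progressionWeight-%3ʳ n c)
  (weight-cong (c + 2 * n) (c % 3 + 2 * n) (%-cong-+ʳ (2 * n) {c} {c % 3} (sym (m%n%n≡m%n c 3))))

progressionWeight-%3 : ∀ n c → progressionWeight n c ≡ progressionWeight (n % 3) (c % 3)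
progressionWeight-%3 n c = trans (progressionWeight-%3ˡ n c) (progressionWeight-%3ʳ (n % 3) c)

progressionWeight-from-%3 : ∀ n {r} c → n % 3 ≡ r → progressionWeight n c ≡ progressionWeight r c
progressionWeight-from-%3 n c n≡r = trans (progressionWeight-%3ˡ n c) (cong (λ l → progressionWeight l c) n≡r)

-- The total weight of the levels 1, …, M: level 2j contributes weight (4j), level 2j + 1
-- contributes weight (4j + 2) ⊕ weight (4j + 4), and levels 0, 1 contribute nothing.
completeLevels : ℕ → ℤ²
completeLevels 0 = 0ℤ²
completeLevels 1 = 0ℤ²
completeLevels (suc (suc M)) = if isEven M then weight (2 * (2 + M)) else 0ℤ²

completeLevels-odd : ∀ M → isEven M ≡ true → completeLevels (suc M) ≡ 0ℤ²
completeLevels-odd zero _ = refl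
completeLevels-odd (suc M) e with isEven M in e′
... | false = refl
... | true = case trans (sym e) (trans (isEven-suc M) (cong not e′)) of λ ()

completeLevels-even : ∀ M → isEven M ≡ false → completeLevels (suc M) ≡ weight (2 * suc M)
completeLevels-even (suc M) e with isEven M in e′
... | true = refl
... | false = case trans (sym e) (trans (isEven-suc M) (cong not e′)) of λ ()

level-weight : ∀ M → completeLevels M ⊕ progressionWeight (#defects≥ (suc M) 0) (2 * suc M) ≡ completeLevels (suc M)
level-weight zero rewrite #defects≥-none {1} {0} (λ t _ → ¬defect-level1) = refl
level-weight (suc M) with isEven M in e
... | true with j , refl ← isEven⇒double M e = begin
  completeLevels (suc M) ⊕ progressionWeight (#defects≥ (2 + M) 0) c
    ≡⟨ cong₂ _⊕_ (completeLevels-odd M e) (progressionWeight-from-%3 (#defects≥ (2 + M) 0) c (#defects≥-of-defect d)) ⟩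
  0ℤ² ⊕ (0ℤ² ⊕ weight (c + 2 * 0))
    ≡⟨ trans (⊕-identityˡ (0ℤ² ⊕ weight (c + 2 * 0))) (trans (⊕-identityˡ (weight (c + 2 * 0))) (cong weight (+-identityʳ c))) ⟩
  weight c ∎
  where
  open ≡-Reasoning
  c = 2 * (2 + M)
  d : Defect (2 + M) 0
  d = subst (λ m → Defect m 0) (2 * suc j ≡ 2 + 2 * j ∋ solve (j ∷ [])) (defect-even-level (suc j))
... | false with j , refl ← ¬isEven⇒odd M e = begin
  completeLevels (suc M) ⊕ progressionWeight (#defects≥ (2 + M) 0) c
    ≡⟨ cong₂ _⊕_ (completeLevels-even M e)
                 (progressionWeight-from-%3 (#defects≥ (2 + M) 0) c (trans (cong (_% 3) (#defects≥-no (λ d₀ → defect⇒¬defect-suc d₀ d)))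
                                                     (#defects≥-of-defect d))) ⟩
  weight (2 * suc M) ⊕ (0ℤ² ⊕ weight (c + 2 * 0) ⊕ weight (c + 2 * 1))
    ≡⟨ cong (λ v → weight (2 * suc M) ⊕ (v ⊕ weight (c + 2 * 1))) (⊕-identityˡ (weight (c + 2 * 0))) ⟩
  weight (2 * suc M) ⊕ (weight (c + 2 * 0) ⊕ weight (c + 2 * 1))
    ≡⟨ ⊕-assoc (weight (2 * suc M)) (weight (c + 2 * 0)) (weight (c + 2 * 1)) ⟨
  weight (2 * suc M) ⊕ weight (c + 2 * 0) ⊕ weight (c + 2 * 1)
    ≡⟨ cong₂ (λ u v → weight (2 * suc M) ⊕ weight u ⊕ weight v)
             (2 * (2 + M) + 2 * 0 ≡ 2 * suc M + 2 ∋ solve (j ∷ []))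
             (2 * (2 + M) + 2 * 1 ≡ 2 * suc M + 4 ∋ solve (j ∷ [])) ⟩
  weight (2 * suc M) ⊕ weight (2 * suc M + 2) ⊕ weight (2 * suc M + 4)
    ≡⟨ step-2-weights≡0 (2 * suc M) ⟩
  0ℤ² ∎
  where
  open ≡-Reasoning
  c = 2 * (2 + M)
  d : Defect (2 + M) 1
  d = subst (λ m → Defect m 1) (3 + 2 * j ≡ 2 + (1 + 2 * j) ∋ solve (j ∷ [])) (defect-odd-level j)

levelBase : Bool → ℕ → ℤ²
levelBase e z = if e then residueWeight z else 0ℤ²

completeLevels≡levelBase : ∀ M → completeLevels (suc M) ≡ levelBase (isEven (suc M)) ((2 * suc M) % 3)
completeLevels≡levelBase M with isEven M in e
... | true = trans (completeLevels-odd M e) (cong (λ b → levelBase b ((2 * suc M) % 3)) (sym (trans (isEven-suc M) (cong not e))))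
... | false = trans (completeLevels-even M e) (cong (λ b → levelBase b ((2 * suc M) % 3)) (sym (trans (isEven-suc M) (cong not e))))

small-table : (f : Bool → ℕ → ℕ → ℤ²) →
  {True (allUpTo? (λ z → allUpTo? (λ i → T? (isSmall (f true z i)) ×-dec T? (isSmall (f false z i))) 3) 3)} →
  ∀ e {z} → z < 3 → ∀ {i} → i < 3 → Small (f e z i)
small-table f {p} true z<3 i<3 = proj₁ (toWitness p z<3 i<3)
small-table f {p} false z<3 i<3 = proj₂ (toWitness p z<3 i<3)

table-none : ∀ e {z} → z < 3 → ∀ {i} → i < 3 →
  Small (levelBase e z ⊕ progressionWeight i ((z + 2) % 3) ⊕ 0ℤ²)
table-none = small-table (λ e z i → levelBase e z ⊕ progressionWeight i ((z + 2) % 3) ⊕ 0ℤ²)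

table-lower : ∀ e {z} → z < 3 → ∀ {i} → i < 3 →
  Small (levelBase e z ⊕ progressionWeight i ((z + 2) % 3) ⊕ progressionWeight i ((z + 1) % 3))
table-lower = small-table (λ e z i → levelBase e z ⊕ progressionWeight i ((z + 2) % 3) ⊕ progressionWeight i ((z + 1) % 3))

table-upper : ∀ e {z} → z < 3 → ∀ {i} → i < 3 →
  Small (levelBase e z ⊕ progressionWeight ((i + 2) % 3) ((z + 2) % 3) ⊕ progressionWeight i ((z + 1) % 3))
table-upper = small-table (λ e z i → levelBase e z ⊕ progressionWeight ((i + 2) % 3) ((z + 2) % 3) ⊕ progressionWeight i ((z + 1) % 3))

three-step-walk : ∀ {x y z} → x < 3 → y < 3 → z < 3 →
  Small (0ℤ² ⊕ residueWeight x ⊕ residueWeight y) →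
  Small (0ℤ² ⊕ residueWeight x ⊕ residueWeight y ⊕ residueWeight z) →
  0ℤ² ⊕ residueWeight x ⊕ residueWeight y ⊕ residueWeight z ≡ 0ℤ² × x ≢ y × x ≢ z × y ≢ z
three-step-walk {0} {1} {2} _ _ _ _ _ = refl , (λ ()) , (λ ()) , (λ ())
three-step-walk {0} {2} {1} _ _ _ _ _ = refl , (λ ()) , (λ ()) , (λ ())
three-step-walk {1} {0} {2} _ _ _ _ _ = refl , (λ ()) , (λ ()) , (λ ())
three-step-walk {1} {2} {0} _ _ _ _ _ = refl , (λ ()) , (λ ()) , (λ ())
three-step-walk {2} {0} {1} _ _ _ _ _ = refl , (λ ()) , (λ ()) , (λ ())
three-step-walk {2} {1} {0} _ _ _ _ _ = refl , (λ ()) , (λ ()) , (λ ())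
three-step-walk {0} {0} _ _ _ () _
three-step-walk {1} {1} _ _ _ () _
three-step-walk {2} {2} _ _ _ () _
three-step-walk {0} {1} {0} _ _ _ _ ()
three-step-walk {0} {1} {1} _ _ _ _ ()
three-step-walk {0} {2} {0} _ _ _ _ ()
three-step-walk {0} {2} {2} _ _ _ _ ()
three-step-walk {1} {0} {0} _ _ _ _ ()
three-step-walk {1} {0} {1} _ _ _ _ ()
three-step-walk {1} {2} {1} _ _ _ _ ()
three-step-walk {1} {2} {2} _ _ _ _ ()
three-step-walk {2} {0} {0} _ _ _ _ ()
three-step-walk {2} {0} {2} _ _ _ _ ()
three-step-walk {2} {1} {1} _ _ _ _ ()
three-step-walk {2} {1} {2} _ _ _ _ ()
three-step-walk {suc (suc (suc _))} (s≤s (s≤s (s≤s ()))) _ _ _ _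
three-step-walk {y = suc (suc (suc _))} _ (s≤s (s≤s (s≤s ()))) _ _ _
three-step-walk {z = suc (suc (suc _))} _ _ (s≤s (s≤s (s≤s ()))) _ _

four-residues-repeat : ∀ {w} → w < 3 → ∀ {x} → x < 3 → ∀ {y} → y < 3 → ∀ {z} → z < 3 →
  ¬ (w ≢ x × w ≢ y × w ≢ z × x ≢ y × x ≢ z × y ≢ z)
four-residues-repeat = from-yes (allUpTo? (λ w → allUpTo? (λ x → allUpTo? (λ y → allUpTo? (λ z →
  ¬? (¬? (w ≟ x) ×-dec ¬? (w ≟ y) ×-dec ¬? (w ≟ z) ×-dec ¬? (x ≟ y) ×-dec ¬? (x ≟ z) ×-dec ¬? (y ≟ z)))
  3) 3) 3) 3)

module _ (f : ℕ → ℕ) (f0≢f1 : f 0 ≢ f 1) (f0≢f2 : f 0 ≢ f 2) (f1≢f2 : f 1 ≢ f 2) where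
  private
    injective : ∀ {i j} → i < 3 → j < 3 → f i ≡ f j → i ≡ j
    injective {0} {0} _ _ _ = refl
    injective {0} {1} _ _ e = ⊥-elim (f0≢f1 e)
    injective {0} {2} _ _ e = ⊥-elim (f0≢f2 e)
    injective {1} {0} _ _ e = ⊥-elim (f0≢f1 (sym e))
    injective {1} {1} _ _ _ = refl
    injective {1} {2} _ _ e = ⊥-elim (f1≢f2 e)
    injective {2} {0} _ _ e = ⊥-elim (f0≢f2 (sym e))
    injective {2} {1} _ _ e = ⊥-elim (f1≢f2 (sym e))
    injective {2} {2} _ _ _ = refl
    injective {suc (suc (suc _))} (s≤s (s≤s (s≤s ()))) _ _
    injective {j = suc (suc (suc _))} _ (s≤s (s≤s (s≤s ()))) _

    unique : ∀ {i r} → i < 3 → f i ≡ r → ∀ j → j < 3 → f j ≡ r → j ≡ i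
    unique i<3 fi≡r j j<3 fj≡r = injective j<3 i<3 (trans fj≡r (sym fi≡r))

  distinct⇒each-residue-once : (∀ i → f i < 3) →
    ∀ r → r < 3 → Σ ℕ λ i → i < 3 × f i ≡ r × (∀ j → j < 3 → f j ≡ r → j ≡ i)
  distinct⇒each-residue-once f<3 r r<3 with f 0 ≟ r | f 1 ≟ r | f 2 ≟ r
  ... | yes e  | _      | _      = 0 , s≤s z≤n , e , unique (s≤s z≤n) e
  ... | no _   | yes e  | _      = 1 , s≤s (s≤s z≤n) , e , unique (s≤s (s≤s z≤n)) e
  ... | no _   | no _   | yes e  = 2 , ≤-refl , e , unique ≤-refl e
  ... | no ¬e₀ | no ¬e₁ | no ¬e₂ =
    ⊥-elim (four-residues-repeat r<3 (f<3 0) (f<3 1) (f<3 2)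
             ((¬e₀ ∘ sym) , (¬e₁ ∘ sym) , (¬e₂ ∘ sym) , f0≢f1 , f0≢f2 , f1≢f2))

module Enumeration {G : ℕ → Set} (G? : ∀ x → Dec (G x)) (G0 : G 0)
                   (a : ℕ) (0<a : 0 < a) (shift : ∀ {x} → G x → G (x + a)) where

  first-member : ∀ lo n → G (lo + n) → Σ ℕ λ y → lo ≤ y × G y × (∀ z → lo ≤ z → z < y → ¬ G z)
  first-member lo n G[lo+n] with G? lo
  ... | yes Glo = lo , ≤-refl , Glo , λ z lo≤z z<lo _ → <⇒≱ z<lo lo≤z
  first-member lo zero G[lo] | no ¬Glo = ⊥-elim (¬Glo (subst G (+-identityʳ lo) G[lo]))
  first-member lo (suc n) G[lo+n] | no ¬Glo
    with y , lo<y , Gy , gap ← first-member (suc lo) n (subst G (+-suc lo n) G[lo+n]) =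
    y , <⇒≤ lo<y , Gy , gap′
    where
    gap′ : ∀ z → lo ≤ z → z < y → ¬ G z
    gap′ z lo≤z z<y with m≤n⇒m<n∨m≡n lo≤z
    ... | inj₁ lo<z = gap z lo<z z<y
    ... | inj₂ refl = ¬Glo

  Successor : ℕ → Set
  Successor x = Σ ℕ λ y → x < y × G y × (∀ z → x < z → z < y → ¬ G z)

  successor : ∀ {x} → G x → Successor x
  successor {x} Gx = first-member (suc x) (a ∸ 1) (subst G x+a≡ (shift Gx))
    where
    x+a≡ : x + a ≡ suc x + (a ∸ 1)
    x+a≡ = trans (cong (x +_) (sym (m+[n∸m]≡n 0<a))) (+-suc x (a ∸ 1))

  opaque
    member : ℕ → Σ ℕ G
    member zero = 0 , G0
    member (suc i) = proj₁ next , proj₁ (proj₂ (proj₂ next))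
      where
      next : Successor (proj₁ (member i))
      next = successor (proj₂ (member i))

    g : ℕ → ℕ
    g i = proj₁ (member i)

    g-zero : g 0 ≡ 0
    g-zero = refl

    g-member : ∀ i → G (g i)
    g-member i = proj₂ (member i)

    g-increasing : ∀ i → g i < g (suc i)
    g-increasing i = proj₁ (proj₂ (successor {g i} (g-member i)))

    g-gap : ∀ i z → g i < z → z < g (suc i) → ¬ G z
    g-gap i = proj₂ (proj₂ (proj₂ (successor {g i} (g-member i))))

  g-next : ∀ i {y} → G y → g i < y → (∀ z → g i < z → z < y → ¬ G z) → g (suc i) ≡ y
  g-next i {y} Gy gi<y gap with <-cmp (g (suc i)) y
  ... | tri< gi+1<y _ _ = ⊥-elim (gap (g (suc i)) (g-increasing i) gi+1<y (g-member (suc i)))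
  ... | tri≈ _ gi+1≡y _ = gi+1≡y
  ... | tri> _ _ y<gi+1 = ⊥-elim (g-gap i y gi<y y<gi+1 Gy)

  g-exhaustive : ∀ x → G x → Σ ℕ λ i → g i ≡ x
  g-exhaustive x Gx = search x 0 (subst (_≤ x) (sym g-zero) z≤n) (subst (λ y → x ≤ x + y) (sym g-zero) (m≤m+n x 0))
    where
    search : ∀ F i → g i ≤ x → x ≤ F + g i → Σ ℕ λ j → g j ≡ x
    search F i gi≤x x≤ with m≤n⇒m<n∨m≡n gi≤x
    ... | inj₂ gi≡x = i , gi≡x
    ... | inj₁ gi<x with x <? g (suc i)
    ...   | yes x<gi+1 = ⊥-elim (g-gap i x gi<x x<gi+1 Gx)
    search zero i gi≤x x≤ | inj₁ gi<x | no _ = ⊥-elim (<⇒≱ gi<x x≤)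
    search (suc F) i gi≤x x≤ | inj₁ gi<x | no x≮gi+1 =
      search F (suc i) (≮⇒≥ x≮gi+1) (≤-trans x≤ (≤-trans (≤-reflexive (sym (+-suc F (g i)))) (+-monoʳ-≤ F (g-increasing i))))

  imbalance : ℕ → ℤ²
  imbalance zero = 0ℤ²
  imbalance (suc x) = imbalance x ⊕ (if does (G? (suc x)) then weight (suc x) else 0ℤ²)

  imbalance-member : ∀ {x} → G (suc x) → imbalance (suc x) ≡ imbalance x ⊕ weight (suc x)
  imbalance-member {x} Gx =
    cong (λ b → imbalance x ⊕ (if b then weight (suc x) else 0ℤ²)) (dec-true (G? (suc x)) Gx)

  imbalance-nonmember : ∀ {x} → ¬ G (suc x) → imbalance (suc x) ≡ imbalance x
  imbalance-nonmember {x} ¬Gx = trans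
    (cong (λ b → imbalance x ⊕ (if b then weight (suc x) else 0ℤ²)) (dec-false (G? (suc x)) ¬Gx))
    (⊕-identityʳ (imbalance x))

  imbalance-gap : ∀ u n → (∀ z → u < z → z ≤ u + n → ¬ G z) → imbalance (u + n) ≡ imbalance u
  imbalance-gap u zero _ = cong imbalance (+-identityʳ u)
  imbalance-gap u (suc n) gap = begin
    imbalance (u + suc n)      ≡⟨ cong imbalance (+-suc u n) ⟩
    imbalance (suc (u + n))    ≡⟨ imbalance-nonmember (gap _ (s≤s (m≤m+n u n)) (≤-reflexive (sym (+-suc u n)))) ⟩
    imbalance (u + n)          ≡⟨ imbalance-gap u n (λ z u<z z≤ → gap z u<z (≤-trans z≤ (+-monoʳ-≤ u (n≤1+n n)))) ⟩
    imbalance u                ∎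
    where open ≡-Reasoning

  imbalance-next : ∀ i → imbalance (g (suc i)) ≡ imbalance (g i) ⊕ weight (g (suc i))
  imbalance-next i with n , gi+1+n≡ ← ≤-to-+ (g-increasing i) = begin
    imbalance (g (suc i))         ≡⟨ cong imbalance (sym gi+1+n≡) ⟩
    imbalance (suc (g i + n))     ≡⟨ imbalance-member (subst G (sym gi+1+n≡) (g-member (suc i))) ⟩
    imbalance (g i + n) ⊕ weight (suc (g i + n))
      ≡⟨ cong₂ _⊕_ (imbalance-gap (g i) n (λ z gi<z z≤ → g-gap i z gi<z (≤-trans (s≤s z≤) (≤-reflexive gi+1+n≡))))
                   (cong weight gi+1+n≡) ⟩
    imbalance (g i) ⊕ weight (g (suc i)) ∎
    where open ≡-Reasoning

  blockResidue : ℕ → ℕ → ℕ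
  blockResidue j i = g (j * 3 + suc i) % 3

  imbalance-in-block : ∀ j i →
    imbalance (g (j * 3 + suc i)) ≡ imbalance (g (j * 3 + i)) ⊕ residueWeight (blockResidue j i)
  imbalance-in-block j i = subst (λ n → imbalance (g n) ≡ imbalance (g (j * 3 + i)) ⊕ weight (g n))
                                 (sym (+-suc (j * 3) i)) (imbalance-next (j * 3 + i))

  module _ (small : ∀ x → Small (imbalance x)) where

    block-walk : ∀ j → imbalance (g (j * 3)) ≡ 0ℤ² →
      imbalance (g (suc j * 3)) ≡ 0ℤ² ×
      blockResidue j 0 ≢ blockResidue j 1 × blockResidue j 0 ≢ blockResidue j 2 × blockResidue j 1 ≢ blockResidue j 2
    block-walk j I≡0 = trans (cong (imbalance ∘ g) (suc j * 3 ≡ j * 3 + 3 ∋ solve (j ∷ []))) (trans I₃ sum≡0) , distinct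
      where
      w : ℕ → ℤ²
      w i = residueWeight (blockResidue j i)
      I₁ : imbalance (g (j * 3 + 1)) ≡ 0ℤ² ⊕ w 0
      I₁ = trans (imbalance-in-block j 0) (cong (_⊕ w 0) (trans (cong (imbalance ∘ g) (+-identityʳ (j * 3))) I≡0))
      I₂ : imbalance (g (j * 3 + 2)) ≡ 0ℤ² ⊕ w 0 ⊕ w 1
      I₂ = trans (imbalance-in-block j 1) (cong (_⊕ w 1) I₁)
      I₃ : imbalance (g (j * 3 + 3)) ≡ 0ℤ² ⊕ w 0 ⊕ w 1 ⊕ w 2
      I₃ = trans (imbalance-in-block j 2) (cong (_⊕ w 2) I₂)
      walk = three-step-walk (m%n<n (g (j * 3 + 1)) 3) (m%n<n (g (j * 3 + 2)) 3) (m%n<n (g (j * 3 + 3)) 3)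
               (subst Small I₂ (small _)) (subst Small I₃ (small _))
      sum≡0 = proj₁ walk
      distinct = proj₂ walk

    balanced : ∀ j → imbalance (g (j * 3)) ≡ 0ℤ²
    balanced zero = cong imbalance g-zero
    balanced (suc j) = proj₁ (block-walk j (balanced j))

    blocks-permute-residues : ∀ j r → r < 3 → Σ ℕ λ i → i < 3 × g (j * 3 + suc i) % 3 ≡ r ×
                                (∀ i′ → i′ < 3 → g (j * 3 + suc i′) % 3 ≡ r → i′ ≡ i)
    blocks-permute-residues j with _ , d01 , d02 , d12 ← block-walk j (balanced j) =
      distinct⇒each-residue-once (blockResidue j) d01 d02 d12 (λ i → m%n<n (g (j * 3 + suc i)) 3)

⟨⟩-closed : ∀ {S x y} → ⟨ S ⟩ x → ⟨ S ⟩ y → ⟨ S ⟩ (x + y)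
⟨⟩-closed gen-zero Gy = Gy
⟨⟩-closed {S} {y = y} (gen-add {x} {s} s∈S Gx) Gy = subst ⟨ S ⟩ (sym (+-assoc s x y)) (gen-add s∈S (⟨⟩-closed Gx Gy))

module Semigroup (k : ℕ) (1≤k : 1 ≤ k) where

  h : ℕ
  h = 6 * k + 2

  S : List ℕ
  S = 12 * k + 4 ∷ 18 * k + 3 ∷ 18 * k + 5 ∷ []

  G : ℕ → Set
  G = ⟨ S ⟩

  Representation : ℕ → Set
  Representation x = Σ ℕ λ s → Σ ℕ λ q → Σ ℕ λ r → r ≤ q × x ≡ s * (12 * k + 4) + q * (18 * k + 3) + 2 * r

  G⇒representation : ∀ {x} → G x → Representation x
  G⇒representation gen-zero = 0 , 0 , 0 , z≤n , refl
  G⇒representation (gen-add (here refl) Gx) with s , q , r , r≤q , refl ← G⇒representation Gx =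
    suc s , q , r , r≤q , solve (k ∷ s ∷ q ∷ r ∷ [])
  G⇒representation (gen-add (there (here refl)) Gx) with s , q , r , r≤q , refl ← G⇒representation Gx =
    s , suc q , r , m≤n⇒m≤1+n r≤q , solve (k ∷ s ∷ q ∷ r ∷ [])
  G⇒representation (gen-add (there (there (here refl))) Gx) with s , q , r , r≤q , refl ← G⇒representation Gx =
    s , suc q , suc r , s≤s r≤q , solve (k ∷ s ∷ q ∷ r ∷ [])

  add-copies : ∀ {c x} → c ∈ S → (n : ℕ) → G x → G (n * c + x)
  add-copies c∈S zero Gx = Gx
  add-copies {c} {x} c∈S (suc n) Gx = subst G (sym (+-assoc c (n * c) x)) (gen-add c∈S (add-copies c∈S n Gx))

  representation⇒G : ∀ {x} → Representation x → G x
  representation⇒G (s , q , r , r≤q , refl) with d , refl ← ≤-to-+ r≤q =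
    subst G regroup
      (add-copies (here refl) s (add-copies (there (here refl)) d (add-copies (there (there (here refl))) r gen-zero)))
    where
    regroup : s * (12 * k + 4) + (d * (18 * k + 3) + (r * (18 * k + 5) + 0))
              ≡ s * (12 * k + 4) + (r + d) * (18 * k + 3) + 2 * r
    regroup = solve (k ∷ s ∷ r ∷ d ∷ [])

  opaque
    G? : ∀ x → Dec (G x)
    G? x = map′ (representation⇒G ∘ unpack) (pack ∘ G⇒representation)
      (anyUpTo? (λ s → anyUpTo? (λ q → anyUpTo? (λ r → r ≤? q ×-dec x ≟ s * (12 * k + 4) + q * (18 * k + 3) + 2 * r)
        (suc x)) (suc x)) (suc x))
      where
      Witness : Set
      Witness = ∃ λ s → s < suc x × ∃ λ q → q < suc x × ∃ λ r → r < suc x ×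
                  r ≤ q × x ≡ s * (12 * k + 4) + q * (18 * k + 3) + 2 * r
      unpack : Witness → Representation x
      unpack (s , _ , q , _ , r , _ , rest) = s , q , r , rest
      pack : Representation x → Witness
      pack (s , q , r , r≤q , refl) = s , s≤s s≤x , q , s≤s q≤x , r , s≤s (≤-trans r≤q q≤x) , r≤q , refl
        where
        s≤x : s ≤ s * (12 * k + 4) + q * (18 * k + 3) + 2 * r
        s≤x = ≤-from-+ (s * (12 * k + 3) + q * (18 * k + 3) + 2 * r) (solve (k ∷ s ∷ q ∷ r ∷ []))
        q≤x : q ≤ s * (12 * k + 4) + q * (18 * k + 3) + 2 * r
        q≤x = ≤-from-+ (s * (12 * k + 4) + q * (18 * k + 2) + 2 * r) (solve (k ∷ s ∷ q ∷ r ∷ []))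

  representation⇒defect : ∀ {x} → Representation x → Σ ℕ λ m → Σ ℕ λ t → Defect m t × x + t ≡ m * h
  representation⇒defect (s , q , r , r≤q , refl) =
    2 * s + 3 * q , 3 * q ∸ 2 * r , defect s q r r≤q refl (m∸n+n≡m 2r≤3q) , (begin
      s * (12 * k + 4) + q * (18 * k + 3) + 2 * r + (3 * q ∸ 2 * r)
        ≡⟨ +-assoc (s * (12 * k + 4) + q * (18 * k + 3)) (2 * r) _ ⟩
      s * (12 * k + 4) + q * (18 * k + 3) + (2 * r + (3 * q ∸ 2 * r))
        ≡⟨ cong (s * (12 * k + 4) + q * (18 * k + 3) +_) (m+[n∸m]≡n 2r≤3q) ⟩
      s * (12 * k + 4) + q * (18 * k + 3) + 3 * q
        ≡⟨ solve (k ∷ s ∷ q ∷ []) ⟩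
      (2 * s + 3 * q) * (6 * k + 2) ∎)
    where
    open ≡-Reasoning
    2r≤3q : 2 * r ≤ 3 * q
    2r≤3q = ≤-trans (*-monoʳ-≤ 2 r≤q) (*-monoˡ-≤ q (n≤1+n 2))

  element-of-defect : ∀ {x t} s q r → x + t ≡ (2 * s + 3 * q) * h → t + 2 * r ≡ 3 * q →
                      x ≡ s * (12 * k + 4) + q * (18 * k + 3) + 2 * r
  element-of-defect {x} {t} s q r x+t≡ t+2r≡ = +-cancelʳ-≡ t x _ (begin
    x + t                                               ≡⟨ x+t≡ ⟩
    (2 * s + 3 * q) * (6 * k + 2)                       ≡⟨ solve (k ∷ s ∷ q ∷ []) ⟩
    s * (12 * k + 4) + q * (18 * k + 3) + 3 * q         ≡⟨ cong (s * (12 * k + 4) + q * (18 * k + 3) +_) t+2r≡ ⟨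
    s * (12 * k + 4) + q * (18 * k + 3) + (t + 2 * r)   ≡⟨ solve (k ∷ s ∷ q ∷ t ∷ r ∷ []) ⟩
    s * (12 * k + 4) + q * (18 * k + 3) + 2 * r + t     ∎)
    where open ≡-Reasoning

  defect⇒representation : ∀ {x m t} → Defect m t → x + t ≡ m * h → Representation x
  defect⇒representation (defect s q r r≤q m≡ t+2r≡) x+t≡ =
    s , q , r , r≤q , element-of-defect s q r (trans x+t≡ (cong (_* h) m≡)) t+2r≡

  defect⇒G : ∀ {x m t} → Defect m t → x + t ≡ m * h → G x
  defect⇒G d eq = representation⇒G (defect⇒representation d eq)

  q-large : ∀ {q} → 12 * k + 4 ≤ 3 * q → 4 * k + 2 ≤ q
  q-large {q} 12k+4≤3q with 4 * k + 2 ≤? q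
  ... | yes 4k+2≤q = 4k+2≤q
  ... | no 4k+2≰q = ⊥-elim (<⇒≱ (s≤s (*-monoʳ-≤ 3 q≤4k+1)) (subst (_≤ 3 * q) (12 * k + 4 ≡ suc (3 * (4 * k + 1)) ∋ solve (k ∷ [])) 12k+4≤3q))
    where
    q≤4k+1 : q ≤ 4 * k + 1
    q≤4k+1 = ≤-pred (subst (suc q ≤_) (4 * k + 2 ≡ suc (4 * k + 1) ∋ solve (k ∷ [])) (≰⇒> 4k+2≰q))

  -- A defect of at least 2h needs q ≥ 4k + 2, which pushes the level beyond 12k + 5
  -- and the element beyond (4k + 2)(18k + 3).
  large-defect⇒level : ∀ {m t} → Defect m t → 12 * k + 4 ≤ t → 12 * k + 6 ≤ m
  large-defect⇒level {m} {t} (defect s q r _ m≡ t+2r≡) 2h≤t =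
    subst (12 * k + 6 ≤_) (sym m≡) (≤-trans (≤-trans (≤-reflexive (12 * k + 6 ≡ 3 * (4 * k + 2) ∋ solve (k ∷ []))) (*-monoʳ-≤ 3 q≥)) (m≤n+m (3 * q) (2 * s)))
    where
    q≥ : 4 * k + 2 ≤ q
    q≥ = q-large (≤-trans 2h≤t (≤-from-+ (2 * r) t+2r≡))

  large-defect⇒element : ∀ {x m t} → Defect m t → x + t ≡ m * h → 12 * k + 4 ≤ t → (4 * k + 2) * (18 * k + 3) ≤ x
  large-defect⇒element {x} (defect s q r _ m≡ t+2r≡) x+t≡ 2h≤t =
    ≤-trans (*-monoˡ-≤ (18 * k + 3) q≥)
      (subst (q * (18 * k + 3) ≤_) (sym (element-of-defect s q r (trans x+t≡ (cong (_* h) m≡)) t+2r≡))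
        (≤-trans (m≤n+m (q * (18 * k + 3)) (s * (12 * k + 4))) (m≤m+n _ (2 * r))))
    where
    q≥ : 4 * k + 2 ≤ q
    q≥ = q-large (≤-trans 2h≤t (≤-from-+ (2 * r) t+2r≡))

  last-window<large-element : (12 * k + 3) * (6 * k + 2) < (4 * k + 2) * (18 * k + 3)
  last-window<large-element = begin-strict
    (12 * k + 3) * (6 * k + 2)           <⟨ m<m+n _ (≤-trans 1≤k (m≤n*m k 6)) ⟩
    (12 * k + 3) * (6 * k + 2) + 6 * k   ≡⟨ solve (k ∷ []) ⟩
    (4 * k + 2) * (18 * k + 3)           ∎
    where open ≤-Reasoning

  -- An element of the window ((M)h, (M+1)h] has level M + 1 or M + 2: lower levels lie
  -- below the window, and level ≥ M + 3 needs a defect ≥ 2h (see large-defect⇒element).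
  window⇒ : ∀ {y M u} → y + u ≡ suc M * h → u < h → M ≤ 12 * k + 2 → G y →
            Defect (suc M) u ⊎ Defect (2 + M) (h + u)
  window⇒ {y} {M} {u} y+u≡ u<h M≤ Gy with m , t , d , y+t≡ ← representation⇒defect (G⇒representation Gy)
                                          | <-cmp m (suc M)
  ... | tri< m<M+1 _ _ = ⊥-elim (<⇒≱ u<h (≤-trans (m≤n+m h t) (+-cancelˡ-≤ y _ _ y+t+h≤y+u)))
    where
    open ≤-Reasoning
    y+t+h≤y+u : y + (t + h) ≤ y + u
    y+t+h≤y+u = begin
      y + (t + h)     ≡⟨ +-assoc y t h ⟨
      y + t + h       ≡⟨ cong (_+ h) y+t≡ ⟩
      m * h + h       ≤⟨ +-monoˡ-≤ h (*-monoˡ-≤ h (≤-pred m<M+1)) ⟩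
      M * h + h       ≡⟨ +-comm (M * h) h ⟩
      suc M * h       ≡⟨ y+u≡ ⟨
      y + u           ∎
  ... | tri≈ _ refl _ = inj₁ (subst (Defect (suc M)) (+-cancelˡ-≡ y t u (trans y+t≡ (sym y+u≡))) d)
  ... | tri> _ _ M+1<m with ≤-to-+ M+1<m
  ...   | zero , refl = inj₂ (subst₂ Defect (+-identityʳ (2 + M)) (+-cancelˡ-≡ y t (h + u) (begin
      y + t                   ≡⟨ y+t≡ ⟩
      (2 + M + 0) * h         ≡⟨ cong (_* h) (+-identityʳ (2 + M)) ⟩
      h + suc M * h           ≡⟨ cong (h +_) y+u≡ ⟨
      h + (y + u)             ≡⟨ +-assoc h y u ⟨
      h + y + u               ≡⟨ cong (_+ u) (+-comm h y) ⟩
      y + h + u               ≡⟨ +-assoc y h u ⟩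
      y + (h + u)             ∎)) d)
    where open ≡-Reasoning
  ...   | suc e , refl = ⊥-elim (<⇒≱ last-window<large-element (≤-trans (large-defect⇒element d y+t≡ 2h≤t) y≤))
    where
    open ≤-Reasoning
    regroup : ∀ n → (2 + M + suc e) * n ≡ suc M * n + (2 + e) * n
    regroup n = solve (M ∷ e ∷ n ∷ [])
    2h≤t : 12 * k + 4 ≤ t
    2h≤t = begin
      12 * k + 4          ≡⟨ solve (k ∷ []) ⟩
      2 * (6 * k + 2)     ≤⟨ *-monoˡ-≤ h (m≤m+n 2 e) ⟩
      (2 + e) * h         ≤⟨ m≤n+m _ u ⟩
      u + (2 + e) * h     ≡⟨ +-cancelˡ-≡ y _ _ (begin-equality
          y + t                         ≡⟨ y+t≡ ⟩
          (2 + M + suc e) * h           ≡⟨ regroup h ⟩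
          suc M * h + (2 + e) * h       ≡⟨ cong (_+ (2 + e) * h) y+u≡ ⟨
          y + u + (2 + e) * h           ≡⟨ +-assoc y u _ ⟩
          y + (u + (2 + e) * h)         ∎) ⟨
      t                   ∎
    y≤ : y ≤ (12 * k + 3) * (6 * k + 2)
    y≤ = begin
      y                   ≤⟨ m≤m+n y u ⟩
      y + u               ≡⟨ y+u≡ ⟩
      suc M * h           ≤⟨ *-monoˡ-≤ h (s≤s M≤) ⟩
      suc (12 * k + 2) * (6 * k + 2) ≡⟨ solve (k ∷ []) ⟩
      (12 * k + 3) * (6 * k + 2) ∎

  window⇐₁ : ∀ {y M u} → y + u ≡ suc M * h → Defect (suc M) u → G y
  window⇐₁ y+u≡ d = defect⇒G d y+u≡

  window⇐₂ : ∀ {y M u} → y + u ≡ suc M * h → Defect (2 + M) (h + u) → G y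
  window⇐₂ {y} {M} {u} y+u≡ d = defect⇒G d (begin
    y + (h + u)       ≡⟨ +-assoc y h u ⟨
    y + h + u         ≡⟨ cong (_+ u) (+-comm y h) ⟩
    h + y + u         ≡⟨ +-assoc h y u ⟩
    h + (y + u)       ≡⟨ cong (h +_) y+u≡ ⟩
    (2 + M) * h       ∎)
    where open ≡-Reasoning

  window-exclusive : ∀ {M u} → Defect (suc M) u → ¬ Defect (2 + M) (h + u)
  window-exclusive {M} {u} d d′ = even⇒¬even-suc {suc M + u} (defect⇒even d) (begin
    suc (suc M + u) % 2                       ≡⟨ [m+kn]%n≡m%n (suc (suc M + u)) (3 * k + 1) 2 ⟨
    (suc (suc M + u) + (3 * k + 1) * 2) % 2   ≡⟨ cong (_% 2) (suc (suc M + u) + (3 * k + 1) * 2 ≡ 2 + M + (6 * k + 2 + u) ∋ solve (M ∷ u ∷ k ∷ [])) ⟩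
    (2 + M + (6 * k + 2 + u)) % 2             ≡⟨ defect⇒even d′ ⟩
    0                                         ∎)
    where open ≡-Reasoning

  0<a : 0 < 12 * k + 4
  0<a = subst (0 <_) (+-comm 4 (12 * k)) (s≤s z≤n)

  instance
    a-nonZero : NonZero (12 * k + 4)
    a-nonZero = >-nonZero 0<a
    h-nonZero : NonZero h
    h-nonZero = >-nonZero (subst (0 <_) (+-comm 2 (6 * k)) (s≤s z≤n))

  shift-by-a : ∀ {x} → G x → G (x + (12 * k + 4))
  shift-by-a {x} Gx = subst G (+-comm (12 * k + 4) x) (gen-add (here refl) Gx)

  open Enumeration G? gen-zero (12 * k + 4) 0<a shift-by-a public

  -- Since h ≡ 2 (mod 3), m h − t ≡ 2m − t ≡ 2m + 2t.
  element-residue : ∀ {y m t n} → y + t ≡ m * h → n % 3 ≡ t % 3 → (2 * m + 2 * n) % 3 ≡ y % 3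
  element-residue {y} {m} {t} {n} y+t≡ n≡t = begin
    (2 * m + 2 * n) % 3                    ≡⟨ %-cong-+ˡ (2 * m) {2 * n} {2 * t} (begin
        (2 * n) % 3                              ≡⟨ %-distribˡ-* 2 n 3 ⟩
        (2 * (n % 3)) % 3                        ≡⟨ cong (λ v → (2 * v) % 3) n≡t ⟩
        (2 * (t % 3)) % 3                        ≡⟨ %-distribˡ-* 2 t 3 ⟨
        (2 * t) % 3                              ∎) ⟩
    (2 * m + 2 * t) % 3                    ≡⟨ [m+kn]%n≡m%n (2 * m + 2 * t) (2 * k * m) 3 ⟨
    (2 * m + 2 * t + 2 * k * m * 3) % 3    ≡⟨ cong (_% 3) (2 * m + 2 * t + 2 * k * m * 3 ≡ m * (6 * k + 2) + 2 * t ∋ solve (m ∷ t ∷ k ∷ [])) ⟩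
    (m * (6 * k + 2) + 2 * t) % 3          ≡⟨ cong (λ v → (v + 2 * t) % 3) y+t≡ ⟨
    (y + t + 2 * t) % 3                    ≡⟨ cong (_% 3) (y + t + 2 * t ≡ y + t * 3 ∋ solve (y ∷ t ∷ [])) ⟩
    (y + t * 3) % 3                        ≡⟨ [m+kn]%n≡m%n y t 3 ⟩
    y % 3                                  ∎
    where open ≡-Reasoning

  -- The imbalance at (M + 1)h − τ, for 0 < τ ≤ h: besides the complete levels ≤ M it counts
  -- the elements of levels M + 1 and M + 2 with defect ≥ τ resp. ≥ h + τ (window⇒).  These
  -- are the top defects of their level, whose residues run through 2m, 2m + 2, … (mod 3).
  closedForm : ℕ → ℕ → ℤ²
  closedForm M τ = completeLevels M ⊕ progressionWeight (#defects≥ (suc M) τ) (2 * suc M)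
                                    ⊕ progressionWeight (#defects≥ (2 + M) (h + τ)) (2 * (2 + M))

  -- Listing the elements of level m from the top defect down, the one with defect t comes
  -- right after the #defects≥ m (suc t) elements above it, so its weight is the next term
  -- of the progression of level m.
  weight-of-element : ∀ {y m t} → Defect m t → y + t ≡ m * h → weight (2 * m + 2 * #defects≥ m (suc t)) ≡ weight y
  weight-of-element {y} {m} {t} d y+t≡ = weight-cong (2 * m + 2 * n) y (element-residue {y} {m} {t} {n} y+t≡
    (%-cancel-+ˡ 1 {n} {t} (trans (cong (_% 3) (sym (#defects≥-yes d))) (#defects≥-of-defect d))))
    where n = #defects≥ m (suc t)

  closedForm-step : ∀ {M x u} → x + suc u ≡ suc M * h → u < h → M ≤ 12 * k + 2 →
                    imbalance x ≡ closedForm M (suc u) → imbalance (suc x) ≡ closedForm M u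
  closedForm-step {M} {x} {u} x+u+1≡ u<h M≤ ih = step (defect? (suc M) u) (defect? (2 + M) (h + u))
    where
    open ≡-Reasoning
    B = completeLevels M
    P₁ P₂ : ℕ → ℤ²
    P₁ n = progressionWeight n (2 * suc M)
    P₂ n = progressionWeight n (2 * (2 + M))
    n₁ = #defects≥ (suc M) (suc u)
    n₂ = #defects≥ (2 + M) (suc (h + u))
    ih′ : imbalance x ≡ B ⊕ P₁ n₁ ⊕ P₂ n₂
    ih′ = trans ih (cong (λ τ → B ⊕ P₁ n₁ ⊕ P₂ (#defects≥ (2 + M) τ)) (+-suc h u))
    y+u≡ : suc x + u ≡ suc M * h
    y+u≡ = trans (sym (+-suc x u)) x+u+1≡
    y+h+u≡ : suc x + (h + u) ≡ (2 + M) * h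
    y+h+u≡ = begin
      suc x + (h + u)   ≡⟨ +-assoc (suc x) h u ⟨
      suc x + h + u     ≡⟨ cong (_+ u) (+-comm (suc x) h) ⟩
      h + suc x + u     ≡⟨ +-assoc h (suc x) u ⟩
      h + (suc x + u)   ≡⟨ cong (h +_) y+u≡ ⟩
      (2 + M) * h       ∎
    step : Dec (Defect (suc M) u) → Dec (Defect (2 + M) (h + u)) → imbalance (suc x) ≡ closedForm M u
    step (yes d₁) (yes d₂) = ⊥-elim (window-exclusive d₁ d₂)
    step (yes d₁) (no ¬d₂) = begin
      imbalance (suc x)                        ≡⟨ imbalance-member (window⇐₁ y+u≡ d₁) ⟩
      imbalance x ⊕ weight (suc x)             ≡⟨ cong (_⊕ weight (suc x)) ih′ ⟩
      B ⊕ P₁ n₁ ⊕ P₂ n₂ ⊕ weight (suc x)       ≡⟨ ⊕-assoc (B ⊕ P₁ n₁) (P₂ n₂) (weight (suc x)) ⟩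
      B ⊕ P₁ n₁ ⊕ (P₂ n₂ ⊕ weight (suc x))     ≡⟨ cong (B ⊕ P₁ n₁ ⊕_) (⊕-comm (P₂ n₂) (weight (suc x))) ⟩
      B ⊕ P₁ n₁ ⊕ (weight (suc x) ⊕ P₂ n₂)     ≡⟨ ⊕-assoc (B ⊕ P₁ n₁) (weight (suc x)) (P₂ n₂) ⟨
      B ⊕ P₁ n₁ ⊕ weight (suc x) ⊕ P₂ n₂       ≡⟨ cong (_⊕ P₂ n₂) (⊕-assoc B (P₁ n₁) (weight (suc x))) ⟩
      B ⊕ (P₁ n₁ ⊕ weight (suc x)) ⊕ P₂ n₂     ≡⟨ cong (λ v → B ⊕ (P₁ n₁ ⊕ v) ⊕ P₂ n₂) (weight-of-element {suc x} d₁ y+u≡) ⟨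
      B ⊕ P₁ (suc n₁) ⊕ P₂ n₂                  ≡⟨ cong₂ (λ v w → B ⊕ P₁ v ⊕ P₂ w) (#defects≥-yes d₁) (#defects≥-no ¬d₂) ⟨
      closedForm M u                           ∎
    step (no ¬d₁) (yes d₂) = begin
      imbalance (suc x)                        ≡⟨ imbalance-member (window⇐₂ y+u≡ d₂) ⟩
      imbalance x ⊕ weight (suc x)             ≡⟨ cong (_⊕ weight (suc x)) ih′ ⟩
      B ⊕ P₁ n₁ ⊕ P₂ n₂ ⊕ weight (suc x)       ≡⟨ ⊕-assoc (B ⊕ P₁ n₁) (P₂ n₂) (weight (suc x)) ⟩
      B ⊕ P₁ n₁ ⊕ (P₂ n₂ ⊕ weight (suc x))     ≡⟨ cong (λ v → B ⊕ P₁ n₁ ⊕ (P₂ n₂ ⊕ v)) (weight-of-element {suc x} d₂ y+h+u≡) ⟨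
      B ⊕ P₁ n₁ ⊕ P₂ (suc n₂)                  ≡⟨ cong₂ (λ v w → B ⊕ P₁ v ⊕ P₂ w) (#defects≥-no ¬d₁) (#defects≥-yes d₂) ⟨
      closedForm M u                           ∎
    step (no ¬d₁) (no ¬d₂) = begin
      imbalance (suc x)                        ≡⟨ imbalance-nonmember (λ G[x+1] → [ ¬d₁ , ¬d₂ ]′ (window⇒ y+u≡ u<h M≤ G[x+1])) ⟩
      imbalance x                              ≡⟨ ih′ ⟩
      B ⊕ P₁ n₁ ⊕ P₂ n₂                        ≡⟨ cong₂ (λ v w → B ⊕ P₁ v ⊕ P₂ w) (#defects≥-no ¬d₁) (#defects≥-no ¬d₂) ⟨
      closedForm M u                           ∎

  no-defects-above-2h : ∀ {m τ} → m ≤ 12 * k + 5 → 12 * k + 4 ≤ τ → #defects≥ m τ ≡ 0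
  no-defects-above-2h {m} m≤ 2h≤τ =
    #defects≥-none (λ t τ≤t d → <⇒≱ (subst (_≤ m) (12 * k + 6 ≡ suc (12 * k + 5) ∋ solve (k ∷ []))
                                                  (large-defect⇒level d (≤-trans 2h≤τ τ≤t))) m≤)

  2h≡ : 6 * k + 2 + (6 * k + 2) ≡ 12 * k + 4
  2h≡ = solve (k ∷ [])

  closedForm-next-window : ∀ M → M ≤ 12 * k + 2 → closedForm M 0 ≡ closedForm (suc M) h
  closedForm-next-window M M≤ = begin
    completeLevels M ⊕ P (#defects≥ (suc M) 0) (2 * suc M) ⊕ P (#defects≥ (2 + M) (h + 0)) (2 * (2 + M))
      ≡⟨ cong₂ (λ u v → u ⊕ P (#defects≥ (2 + M) v) (2 * (2 + M))) (level-weight M) (+-identityʳ h) ⟩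
    completeLevels (suc M) ⊕ P (#defects≥ (2 + M) h) (2 * (2 + M))
      ≡⟨ ⊕-identityʳ _ ⟨
    completeLevels (suc M) ⊕ P (#defects≥ (2 + M) h) (2 * (2 + M)) ⊕ 0ℤ²
      ≡⟨ cong (λ n → completeLevels (suc M) ⊕ P (#defects≥ (2 + M) h) (2 * (2 + M)) ⊕ P n (2 * (3 + M)))
              (no-defects-above-2h (≤-trans (+-monoʳ-≤ 3 M≤) (≤-reflexive (3 + (12 * k + 2) ≡ 12 * k + 5 ∋ solve (k ∷ []))))
                                   (≤-reflexive (sym 2h≡))) ⟨
    closedForm (suc M) h ∎
    where
    open ≡-Reasoning
    P = progressionWeight

  closedForm-initial : imbalance 0 ≡ closedForm 0 h
  closedForm-initial = sym (cong₂ (λ u v → 0ℤ² ⊕ progressionWeight u 2 ⊕ progressionWeight v 4)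
    (#defects≥-none (λ t _ → ¬defect-level1))
    (no-defects-above-2h (≤-from-+ (12 * k + 3) (2 + (12 * k + 3) ≡ 12 * k + 5 ∋ solve (k ∷ []))) (≤-reflexive (sym 2h≡))))

  imbalance≡closedForm : ∀ M → M ≤ 12 * k + 2 → ∀ d τ → d + τ ≡ h → imbalance (M * h + d) ≡ closedForm M τ
  imbalance≡closedForm zero M≤ zero τ refl = closedForm-initial
  imbalance≡closedForm (suc M) M≤ zero τ refl = begin
    imbalance (suc M * h + 0)   ≡⟨ cong imbalance (trans (+-identityʳ (suc M * h)) (+-comm h (M * h))) ⟩
    imbalance (M * h + h)       ≡⟨ imbalance≡closedForm M (≤-trans (n≤1+n M) M≤) h 0 (+-identityʳ h) ⟩
    closedForm M 0              ≡⟨ closedForm-next-window M (≤-trans (n≤1+n M) M≤) ⟩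
    closedForm (suc M) h        ∎
    where open ≡-Reasoning
  imbalance≡closedForm M M≤ (suc d) τ d+τ≡ = begin
    imbalance (M * h + suc d)   ≡⟨ cong imbalance (+-suc (M * h) d) ⟩
    imbalance (suc (M * h + d)) ≡⟨ closedForm-step x+u+1≡ τ<h M≤ (imbalance≡closedForm M M≤ d (suc τ) d+τ+1≡) ⟩
    closedForm M τ              ∎
    where
    open ≡-Reasoning
    d+τ+1≡ : d + suc τ ≡ h
    d+τ+1≡ = trans (+-suc d τ) d+τ≡
    x+u+1≡ : M * h + d + suc τ ≡ suc M * h
    x+u+1≡ = trans (+-assoc (M * h) d (suc τ)) (trans (cong (M * h +_) d+τ+1≡) (+-comm (M * h) h))
    τ<h : τ < h
    τ<h = ≤-from-+ d (trans (+-comm (suc τ) d) d+τ+1≡)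

  closedForm-mod3 : ∀ M τ → let z = (2 * suc M) % 3 in closedForm (suc M) τ ≡
    levelBase (isEven (suc M)) z ⊕ progressionWeight (#defects≥ (2 + M) τ % 3) ((z + 2) % 3)
                                 ⊕ progressionWeight (#defects≥ (3 + M) (h + τ) % 3) ((z + 1) % 3)
  closedForm-mod3 M τ = cong₂ _⊕_ (cong₂ _⊕_ (completeLevels≡levelBase M)
      (trans (progressionWeight-%3 (#defects≥ (2 + M) τ) (2 * (2 + M)))
             (cong (progressionWeight _) (trans (cong (_% 3) (2 * (2 + M) ≡ 2 * suc M + 2 ∋ solve (M ∷ [])))
                                                (%-distribˡ-+ (2 * suc M) 2 3)))))
      (trans (progressionWeight-%3 (#defects≥ (3 + M) (h + τ)) (2 * (3 + M)))
             (cong (progressionWeight _) (trans (cong (_% 3) (2 * (3 + M) ≡ 2 * suc M + 4 ∋ solve (M ∷ [])))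
                                                (%-distribˡ-+ (2 * suc M) 4 3))))

  3≤h : 3 ≤ h
  3≤h = +-monoˡ-≤ 2 (≤-trans 1≤k (m≤n*m k 6))

  defect-one-level-down : ∀ {M τ} → Defect (3 + M) (h + τ) → Defect (2 + M) τ ⊎ Defect (2 + M) (suc τ)
  defect-one-level-down {M} {τ} d = defect-descend τ (h ∸ 3) (defect-level-pred (subst (Defect (3 + M)) regroup d))
    where
    open ≡-Reasoning
    regroup : h + τ ≡ 3 + (τ + (h ∸ 3))
    regroup = begin
      h + τ                 ≡⟨ cong (_+ τ) (m+[n∸m]≡n 3≤h) ⟨
      3 + (h ∸ 3) + τ       ≡⟨ +-assoc 3 (h ∸ 3) τ ⟩
      3 + (h ∸ 3 + τ)       ≡⟨ cong (3 +_) (+-comm (h ∸ 3) τ) ⟩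
      3 + (τ + (h ∸ 3))     ∎

  h+1+τ≡τ : ∀ τ → suc (h + τ) % 3 ≡ τ % 3
  h+1+τ≡τ τ = trans (cong (_% 3) (suc (6 * k + 2 + τ) ≡ τ + (2 * k + 1) * 3 ∋ solve (k ∷ τ ∷ [])))
                    ([m+kn]%n≡m%n τ (2 * k + 1) 3)

  -- Modulo 3 only finitely many cases remain (the tables); which one applies depends on
  -- whether level M + 3 has a defect at h + τ or at h + τ + 1.
  closedForm-small : ∀ M τ → Small (closedForm M τ)
  closedForm-small zero τ = subst Small (sym (cong₂ (λ u v → 0ℤ² ⊕ progressionWeight u 2 ⊕ progressionWeight v 4)
    (#defects≥-none (λ t _ → ¬defect-level1))
    (#defects≥-none (λ t h+τ≤t d → <⇒≱ (≤-trans (≤-trans 3≤h (m≤m+n h τ)) h+τ≤t) (defect⇒≤ d))))) tt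
  closedForm-small (suc M) τ = subst Small (sym (closedForm-mod3 M τ)) reduced
    where
    z = (2 * suc M) % 3
    z<3 = m%n<n (2 * suc M) 3
    n₁ = #defects≥ (2 + M) τ
    n₂ = #defects≥ (3 + M) (h + τ)
    Reduced : ℕ → ℕ → Set
    Reduced i j = Small (levelBase (isEven (suc M)) z ⊕ progressionWeight i ((z + 2) % 3) ⊕ progressionWeight j ((z + 1) % 3))

    upper : Defect (3 + M) (h + τ) → Reduced (n₁ % 3) (n₂ % 3)
    upper d with defect-one-level-down d
    ... | inj₁ d′ = ⊥-elim (window-exclusive d′ d)
    ... | inj₂ d′ = subst₂ Reduced (sym n₁≡) (sym n₂≡) (table-upper (isEven (suc M)) z<3 (m%n<n τ 3))
      where
      n₁≡ : n₁ % 3 ≡ (τ % 3 + 2) % 3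
      n₁≡ = trans (cong (_% 3) (#defects≥-no (λ d₀ → defect⇒¬defect-suc d₀ d′)))
              (trans (#defects≥-of-defect d′) (trans (cong (_% 3) (+-comm 2 τ)) (%-distribˡ-+ τ 2 3)))
      n₂≡ : n₂ % 3 ≡ τ % 3
      n₂≡ = trans (#defects≥-of-defect d) (h+1+τ≡τ τ)

    lower : ¬ Defect (3 + M) (h + τ) → Defect (3 + M) (suc (h + τ)) → Reduced (n₁ % 3) (n₂ % 3)
    lower ¬d d with defect-one-level-down (subst (Defect (3 + M)) (sym (+-suc h τ)) d)
    ... | inj₁ d′ = ⊥-elim (window-exclusive d′ (subst (Defect (3 + M)) (sym (+-suc h τ)) d))
    ... | inj₂ d″ = subst₂ Reduced (sym n₁≡) (sym n₂≡) (table-lower (isEven (suc M)) z<3 (m%n<n (suc τ) 3))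
      where
      n₁≡ : n₁ % 3 ≡ suc τ % 3
      n₁≡ = #defects≥-of-defect (defect-lower d″)
      n₂≡ : n₂ % 3 ≡ suc τ % 3
      n₂≡ = trans (cong (_% 3) (#defects≥-no ¬d)) (trans (#defects≥-of-defect d) (%-cong-+ˡ 1 {suc (h + τ)} {τ} (h+1+τ≡τ τ)))

    reduced : Reduced (n₁ % 3) (n₂ % 3)
    reduced with defect? (3 + M) (h + τ) | defect? (3 + M) (suc (h + τ))
    ... | yes d  | _      = upper d
    ... | no ¬d  | yes d  = lower ¬d d
    ... | no ¬d₁ | no ¬d₂ = subst (λ n → Reduced (n₁ % 3) (n % 3)) (sym (#defects≥-none (no-defect-from ¬d₁ ¬d₂)))
                                  (table-none (isEven (suc M)) z<3 (m%n<n n₁ 3))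

  window-full : ∀ {y M u t₁ t₂} → y + u ≡ suc M * h → Defect (suc M) t₁ → Defect (2 + M) t₂ →
                ((suc M + u) % 2 ≡ 0 → u ≤ t₁) → (¬ ((suc M + u) % 2 ≡ 0) → h + u ≤ t₂) → G y
  window-full {y} {M} {u} y+u≡ d₁ d₂ below₁ below₂ with (suc M + u) % 2 ≟ 0
  ... | yes even = window⇐₁ y+u≡ (defect-below-top d₁ (below₁ even) even)
  ... | no odd = window⇐₂ y+u≡ (defect-below-top d₂ (below₂ odd) (begin
    (2 + M + (h + u)) % 2                     ≡⟨ cong (_% 2) (2 + M + (6 * k + 2 + u) ≡ suc (suc M + u) + (3 * k + 1) * 2
                                                               ∋ solve (M ∷ u ∷ k ∷ [])) ⟩
    (suc (suc M + u) + (3 * k + 1) * 2) % 2   ≡⟨ [m+kn]%n≡m%n (suc (suc M + u)) (3 * k + 1) 2 ⟩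
    suc (suc M + u) % 2                       ≡⟨ ¬even⇒even-suc {suc M + u} odd ⟩
    0                                         ∎))
    where open ≡-Reasoning

  top-defect-12k+4 : Defect (12 * k + 4) h
  top-defect-12k+4 with k′ , refl ← ≤-to-+ 1≤k = defect 2 (4 * (1 + k′)) (3 * k′ + 2) (≤-from-+ (k′ + 2) (r≤q k′)) (m≡ k′) (t≡ k′)
    where
    r≤q : ∀ k′ → 3 * k′ + 2 + (k′ + 2) ≡ 4 * (1 + k′)
    r≤q = solve-∀
    m≡ : ∀ k′ → 12 * (1 + k′) + 4 ≡ 2 * 2 + 3 * (4 * (1 + k′))
    m≡ = solve-∀
    t≡ : ∀ k′ → 6 * (1 + k′) + 2 + 2 * (3 * k′ + 2) ≡ 3 * (4 * (1 + k′))
    t≡ = solve-∀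

  top-defect-12k+5 : Defect (12 * k + 5) (12 * k + 3)
  top-defect-12k+5 = defect 1 (4 * k + 1) 0 z≤n (solve (k ∷ [])) (solve (k ∷ []))

  top-defect-12k+6 : Defect (12 * k + 6) (12 * k + 2)
  top-defect-12k+6 = defect 0 (4 * k + 2) 2 (m≤n+m 2 (4 * k)) (solve (k ∷ [])) (solve (k ∷ []))

  conductor : ℕ
  conductor = (12 * k + 3) * h

  even-18k+6 : ∀ {n} → n ≡ 18 * k + 6 → n % 2 ≡ 0
  even-18k+6 refl = trans (cong (_% 2) (18 * k + 6 ≡ (9 * k + 3) * 2 ∋ solve (k ∷ []))) (m*n%n≡0 (9 * k + 3) 2)

  G-above-conductor : ∀ r → r ≤ h → G (conductor + r)
  G-above-conductor r r≤h = window-full {M = 12 * k + 3} y+u≡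
    (subst (λ m → Defect m h) (12 * k + 4 ≡ suc (12 * k + 3) ∋ solve (k ∷ [])) top-defect-12k+4)
    (subst (λ m → Defect m (12 * k + 3)) (12 * k + 5 ≡ 2 + (12 * k + 3) ∋ solve (k ∷ [])) top-defect-12k+5)
    (λ _ → m∸n≤m h r) below₂
    where
    open ≡-Reasoning
    u = h ∸ r
    y+u≡ : conductor + r + u ≡ suc (12 * k + 3) * h
    y+u≡ = begin
      conductor + r + u       ≡⟨ +-assoc conductor r u ⟩
      conductor + (r + u)     ≡⟨ cong (conductor +_) (m+[n∸m]≡n r≤h) ⟩
      conductor + h           ≡⟨ +-comm conductor h ⟩
      suc (12 * k + 3) * h    ∎
    below₂ : ¬ ((suc (12 * k + 3) + u) % 2 ≡ 0) → h + u ≤ 12 * k + 3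
    below₂ odd with u ≟ h
    ... | yes u≡h = ⊥-elim (odd (even-18k+6 (trans (cong (suc (12 * k + 3) +_) u≡h)
                                                   (suc (12 * k + 3) + (6 * k + 2) ≡ 18 * k + 6 ∋ solve (k ∷ [])))))
    ... | no u≢h = ≤-trans (+-monoʳ-≤ h (≤-pred (subst (suc u ≤_) (6 * k + 2 ≡ suc (6 * k + 1) ∋ solve (k ∷ []))
                                                        (≤∧≢⇒< (m∸n≤m h r) u≢h))))
                           (≤-reflexive (6 * k + 2 + (6 * k + 1) ≡ 12 * k + 3 ∋ solve (k ∷ [])))

  G-above-conductor+h : ∀ j → suc j ≤ h → G (conductor + h + suc j)
  G-above-conductor+h j j<h = window-full {M = 12 * k + 4} y+u≡
    (subst (λ m → Defect m (12 * k + 3)) (12 * k + 5 ≡ suc (12 * k + 4) ∋ solve (k ∷ [])) top-defect-12k+5)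
    (subst (λ m → Defect m (12 * k + 2)) (12 * k + 6 ≡ 2 + (12 * k + 4) ∋ solve (k ∷ [])) top-defect-12k+6)
    (λ _ → ≤-trans u≤6k+1 (≤-from-+ (6 * k + 2) (6 * k + 1 + (6 * k + 2) ≡ 12 * k + 3 ∋ solve (k ∷ []))))
    below₂
    where
    open ≡-Reasoning
    u = h ∸ suc j
    u+j+1≡h : u + suc j ≡ h
    u+j+1≡h = m∸n+n≡m j<h
    u≤6k+1 : u ≤ 6 * k + 1
    u≤6k+1 = ≤-pred (≤-from-+ j (trans (sym (+-suc u j)) (trans u+j+1≡h (6 * k + 2 ≡ suc (6 * k + 1) ∋ solve (k ∷ [])))))
    y+u≡ : conductor + h + suc j + u ≡ suc (12 * k + 4) * h
    y+u≡ = begin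
      conductor + h + suc j + u       ≡⟨ +-assoc (conductor + h) (suc j) u ⟩
      conductor + h + (suc j + u)     ≡⟨ cong (conductor + h +_) (trans (+-comm (suc j) u) u+j+1≡h) ⟩
      (12 * k + 3) * (6 * k + 2) + (6 * k + 2) + (6 * k + 2) ≡⟨ solve (k ∷ []) ⟩
      suc (12 * k + 4) * (6 * k + 2)  ∎
    below₂ : ¬ ((suc (12 * k + 4) + u) % 2 ≡ 0) → h + u ≤ 12 * k + 2
    below₂ odd with u ≟ 6 * k + 1
    ... | yes u≡ = ⊥-elim (odd (even-18k+6 (trans (cong (suc (12 * k + 4) +_) u≡)
                                                  (suc (12 * k + 4) + (6 * k + 1) ≡ 18 * k + 6 ∋ solve (k ∷ [])))))
    ... | no u≢ = ≤-trans (+-monoʳ-≤ h (≤-pred (subst (suc u ≤_) (6 * k + 1 ≡ suc (6 * k) ∋ solve (k ∷ []))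
                                                       (≤∧≢⇒< u≤6k+1 u≢))))
                          (≤-reflexive (6 * k + 2 + 6 * k ≡ 12 * k + 2 ∋ solve (k ∷ [])))

  G-beyond-conductor : ∀ y → conductor ≤ y → G y
  G-beyond-conductor y conductor≤y with i , refl ← ≤-to-+ conductor≤y =
    subst G (trans (+-comm ((i / a) * a) (conductor + i % a))
                   (trans (+-assoc conductor (i % a) _) (cong (conductor +_) (sym (m≡m%n+[m/n]*n i a)))))
            (add-copies (here refl) (i / a) (G-residue (i % a) (m%n<n i a)))
    where
    a = 12 * k + 4
    G-residue : ∀ r → r < a → G (conductor + r)
    G-residue r r<a with r ≤? h
    ... | yes r≤h = G-above-conductor r r≤h
    ... | no r≰h with j , refl ← ≤-to-+ (≰⇒> r≰h) =
      subst G (trans (+-assoc conductor h (suc j)) (cong (conductor +_) (+-suc h j)))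
            (G-above-conductor+h j (<⇒≤ (+-cancelˡ-< h _ _ (subst₂ _<_ (sym (+-suc h j)) (sym 2h≡) r<a))))

  imbalance-conductor : imbalance conductor ≡ 0ℤ²
  imbalance-conductor = begin
    imbalance conductor
      ≡⟨ cong imbalance ((12 * k + 3) * (6 * k + 2) ≡ (12 * k + 2) * (6 * k + 2) + (6 * k + 2) ∋ solve (k ∷ [])) ⟩
    imbalance ((12 * k + 2) * h + h)
      ≡⟨ imbalance≡closedForm M ≤-refl h 0 (+-identityʳ h) ⟩
    closedForm M 0
      ≡⟨ closedForm-next-window M ≤-refl ⟩
    completeLevels (suc M) ⊕ progressionWeight (#defects≥ (2 + M) h) c₁ ⊕ progressionWeight (#defects≥ (3 + M) (h + h)) c₂
      ≡⟨ cong₂ (λ u v → u ⊕ progressionWeight (#defects≥ (2 + M) h) c₁ ⊕ progressionWeight v c₂)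
               (completeLevels-odd M M-even)
               (no-defects-above-2h (≤-reflexive (3 + (12 * k + 2) ≡ 12 * k + 5 ∋ solve (k ∷ []))) (≤-reflexive (sym 2h≡))) ⟩
    0ℤ² ⊕ progressionWeight (#defects≥ (2 + M) h) c₁ ⊕ 0ℤ²
      ≡⟨ cong (λ P → 0ℤ² ⊕ P ⊕ 0ℤ²) (progressionWeight-from-%3 (#defects≥ (2 + M) h) c₁ top-count) ⟩
    0ℤ² ∎
    where
    open ≡-Reasoning
    M = 12 * k + 2
    c₁ = 2 * (2 + M)
    c₂ = 2 * (3 + M)
    M-even : isEven M ≡ true
    M-even = isEven-double (6 * k + 1) (12 * k + 2 ≡ 2 * (6 * k + 1) ∋ solve (k ∷ []))
    top-count : #defects≥ (2 + M) h % 3 ≡ 0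
    top-count = trans (#defects≥-of-defect (subst (λ m → Defect m h) (12 * k + 4 ≡ 2 + (12 * k + 2) ∋ solve (k ∷ [])) top-defect-12k+4))
                      (trans (cong (_% 3) (suc (6 * k + 2) ≡ (2 * k + 1) * 3 ∋ solve (k ∷ []))) (m*n%n≡0 (2 * k + 1) 3))

  imbalance-beyond-step : ∀ i → imbalance (conductor + suc i) ≡ imbalance (conductor + i) ⊕ weight (conductor + suc i)
  imbalance-beyond-step i = begin
    imbalance (conductor + suc i)                              ≡⟨ cong imbalance (+-suc conductor i) ⟩
    imbalance (suc (conductor + i))                            ≡⟨ imbalance-member (G-beyond-conductor _ (≤-trans (m≤m+n conductor i) (n≤1+n _))) ⟩
    imbalance (conductor + i) ⊕ weight (suc (conductor + i))   ≡⟨ cong (λ v → imbalance (conductor + i) ⊕ weight v) (+-suc conductor i) ⟨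
    imbalance (conductor + i) ⊕ weight (conductor + suc i)     ∎
    where open ≡-Reasoning

  imbalance-beyond : ∀ j → imbalance (conductor + 3 * j) ≡ 0ℤ²
  imbalance-beyond zero = trans (cong imbalance (+-identityʳ conductor)) imbalance-conductor
  imbalance-beyond (suc j) = begin
    imbalance (conductor + 3 * suc j)
      ≡⟨ cong (λ n → imbalance (conductor + n)) (3 * suc j ≡ suc (suc (suc (3 * j))) ∋ solve (j ∷ [])) ⟩
    imbalance (conductor + suc (suc (suc (3 * j))))
      ≡⟨ trans (imbalance-beyond-step _) (cong₂ _⊕_
           (trans (imbalance-beyond-step _) (cong₂ _⊕_
             (trans (imbalance-beyond-step _) (cong (_⊕ weight z) (imbalance-beyond j)))
             (cong weight (m+[2+n]≡m+[1+n]+1 conductor (3 * j)))))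
           (cong weight (m+[3+n]≡m+[1+n]+2 conductor (3 * j)))) ⟩
    0ℤ² ⊕ weight z ⊕ weight (z + 1) ⊕ weight (z + 2)
      ≡⟨ cong (λ v → v ⊕ weight (z + 1) ⊕ weight (z + 2)) (⊕-identityˡ (weight z)) ⟩
    weight z ⊕ weight (z + 1) ⊕ weight (z + 2)
      ≡⟨ consecutive-weights≡0 z ⟩
    0ℤ² ∎
    where
    open ≡-Reasoning
    z = conductor + suc (3 * j)

  small-beyond-conductor : ∀ i → Small (imbalance (conductor + i))
  small-beyond-conductor i = subst (λ n → Small (imbalance (conductor + n))) (sym (m≡m%n+[m/n]*n i 3))
                                   (small (i % 3) (i / 3) (m%n<n i 3))
    where
    open ≡-Reasoning
    at-block : ∀ j → imbalance (conductor + j * 3) ≡ 0ℤ²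
    at-block j = trans (cong (λ n → imbalance (conductor + n)) (*-comm j 3)) (imbalance-beyond j)
    small : ∀ r j → r < 3 → Small (imbalance (conductor + (r + j * 3)))
    small 0 j _ = subst Small (sym (at-block j)) tt
    small 1 j _ = subst Small (sym (begin
      imbalance (conductor + suc (j * 3))               ≡⟨ imbalance-beyond-step (j * 3) ⟩
      imbalance (conductor + j * 3) ⊕ weight z          ≡⟨ cong (_⊕ weight z) (at-block j) ⟩
      0ℤ² ⊕ weight z                                    ∎)) (small-one-weight z)
      where z = conductor + suc (j * 3)
    small 2 j _ = subst Small (sym (begin
      imbalance (conductor + suc (suc (j * 3)))                          ≡⟨ imbalance-beyond-step (suc (j * 3)) ⟩
      imbalance (conductor + suc (j * 3)) ⊕ weight (conductor + suc (suc (j * 3)))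
        ≡⟨ cong₂ _⊕_ (trans (imbalance-beyond-step (j * 3)) (cong (_⊕ weight z) (at-block j)))
                     (cong weight (m+[2+n]≡m+[1+n]+1 conductor (j * 3))) ⟩
      0ℤ² ⊕ weight z ⊕ weight (z + 1)                                   ∎)) (small-two-weights z)
      where z = conductor + suc (j * 3)
    small (suc (suc (suc _))) j (s≤s (s≤s (s≤s ())))

  small-below-conductor : ∀ x → x < conductor → Small (imbalance x)
  small-below-conductor x x<conductor =
    subst (λ n → Small (imbalance n)) (sym x≡) (subst Small (sym (imbalance≡closedForm M M≤ d (h ∸ d) (m+[n∸m]≡n (<⇒≤ d<h))))
                                                    (closedForm-small M (h ∸ d)))
    where
    M = x / h
    d = x % h
    d<h : d < h
    d<h = m%n<n x h
    M≤ : M ≤ 12 * k + 2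
    M≤ = ≤-pred (subst (suc M ≤_) (12 * k + 3 ≡ suc (12 * k + 2) ∋ solve (k ∷ [])) (m<n*o⇒m/o<n x<conductor))
    x≡ : x ≡ M * h + d
    x≡ = trans (m≡m%n+[m/n]*n x h) (+-comm d (M * h))

  imbalance-small : ∀ x → Small (imbalance x)
  imbalance-small x with x <? conductor
  ... | yes x<conductor = small-below-conductor x x<conductor
  ... | no x≮conductor with i , refl ← ≤-to-+ (≮⇒≥ x≮conductor) = small-beyond-conductor i

  a<b : 12 * k + 4 < 18 * k + 3
  a<b = subst₂ _≤_ (12 * k + 3 + 2 ≡ suc (12 * k + 4) ∋ solve (k ∷ [])) (12 * k + 3 + 6 * k ≡ 18 * k + 3 ∋ solve (k ∷ []))
               (+-monoʳ-≤ (12 * k + 3) (≤-trans (s≤s (s≤s z≤n)) (*-monoʳ-≤ 6 1≤k)))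

  a≤b : 12 * k + 4 ≤ 18 * k + 3
  a≤b = <⇒≤ a<b

  b<b+2 : 18 * k + 3 < 18 * k + 5
  b<b+2 = ≤-from-+ 1 (suc (18 * k + 3) + 1 ≡ 18 * k + 5 ∋ solve (k ∷ []))

  b+2<2a : 18 * k + 5 < 2 * (12 * k + 4)
  b+2<2a = ≤-from-+ (6 * k + 2) (suc (18 * k + 5) + (6 * k + 2) ≡ 2 * (12 * k + 4) ∋ solve (k ∷ []))

  ZeroOrGenerator : ℕ → Set
  ZeroOrGenerator v = v ≡ 0 ⊎ v ≡ 12 * k + 4 ⊎ v ≡ 18 * k + 3 ⊎ v ≡ 18 * k + 5

  elements-below-2a : ∀ {z} → G z → z < 2 * (12 * k + 4) → ZeroOrGenerator z
  elements-below-2a Gz z<2a with G⇒representation Gz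
  ... | s , suc (suc q) , r , _ , refl = ⊥-elim (<⇒≱ z<2a (begin
    2 * (12 * k + 4)                                          ≤⟨ *-monoʳ-≤ 2 a≤b ⟩
    2 * (18 * k + 3)                                          ≤⟨ *-monoˡ-≤ (18 * k + 3) (s≤s (s≤s (z≤n {q}))) ⟩
    suc (suc q) * (18 * k + 3)                                ≤⟨ m≤n+m _ (s * (12 * k + 4)) ⟩
    s * (12 * k + 4) + suc (suc q) * (18 * k + 3)             ≤⟨ m≤m+n _ (2 * r) ⟩
    s * (12 * k + 4) + suc (suc q) * (18 * k + 3) + 2 * r     ∎))
    where open ≤-Reasoning
  ... | suc s , 1 , r , _ , refl = ⊥-elim (<⇒≱ z<2a (begin
    2 * (12 * k + 4)                                          ≡⟨ solve (k ∷ []) ⟩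
    (12 * k + 4) + (12 * k + 4)                               ≤⟨ +-monoʳ-≤ (12 * k + 4) a≤b ⟩
    (12 * k + 4) + (18 * k + 3)                               ≤⟨ +-monoˡ-≤ (18 * k + 3) (m≤m+n (12 * k + 4) (s * (12 * k + 4))) ⟩
    suc s * (12 * k + 4) + (18 * k + 3)                       ≡⟨ cong (suc s * (12 * k + 4) +_) (*-identityˡ (18 * k + 3)) ⟨
    suc s * (12 * k + 4) + 1 * (18 * k + 3)                   ≤⟨ m≤m+n _ (2 * r) ⟩
    suc s * (12 * k + 4) + 1 * (18 * k + 3) + 2 * r           ∎))
    where open ≤-Reasoning
  ... | 0 , 1 , 0 , _ , refl = inj₂ (inj₂ (inj₁ (solve (k ∷ []))))
  ... | 0 , 1 , 1 , _ , refl = inj₂ (inj₂ (inj₂ (solve (k ∷ []))))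
  ... | 0 , 1 , suc (suc r) , s≤s () , refl
  ... | 0 , 0 , 0 , _ , refl = inj₁ refl
  ... | 1 , 0 , 0 , _ , refl = inj₂ (inj₁ (solve (k ∷ [])))
  ... | suc (suc s) , 0 , 0 , _ , refl = ⊥-elim (<⇒≱ z<2a (begin
    2 * (12 * k + 4)                                          ≤⟨ *-monoˡ-≤ (12 * k + 4) (s≤s (s≤s (z≤n {s}))) ⟩
    suc (suc s) * (12 * k + 4)                                ≡⟨ solve (k ∷ s ∷ []) ⟩
    suc (suc s) * (12 * k + 4) + 0 * (18 * k + 3) + 2 * 0     ∎))
    where open ≤-Reasoning
  ... | _ , 0 , suc r , () , _

  no-element-between : ∀ {lo hi} → hi ≤ 2 * (12 * k + 4) → (∀ {v} → ZeroOrGenerator v → lo < v → v < hi → ⊥) →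
                       ∀ z → lo < z → z < hi → ¬ G z
  no-element-between hi≤2a excluded z lo<z z<hi Gz = excluded (elements-below-2a Gz (<-≤-trans z<hi hi≤2a)) lo<z z<hi

  generator∈G : ∀ {c} → c ∈ S → G c
  generator∈G {c} c∈S = subst G (+-identityʳ c) (gen-add c∈S gen-zero)

  g-1 : g 1 ≡ 12 * k + 4
  g-1 = g-next 0 (generator∈G (here refl)) (subst (_< 12 * k + 4) (sym g-zero) 0<a)
    (subst (λ lo → ∀ z → lo < z → z < 12 * k + 4 → ¬ G z) (sym g-zero) (no-element-between (m≤m+n _ _) λ
      { (inj₁ refl) 0<0 _ → <-irrefl refl 0<0
      ; (inj₂ (inj₁ refl)) _ a<a → <-irrefl refl a<a
      ; (inj₂ (inj₂ (inj₁ refl))) _ b<a → <-asym a<b b<a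
      ; (inj₂ (inj₂ (inj₂ refl))) _ b+2<a → <-asym (<-trans a<b b<b+2) b+2<a }))

  g-2 : g 2 ≡ 18 * k + 3
  g-2 = g-next 1 (generator∈G (there (here refl))) (subst (_< 18 * k + 3) (sym g-1) a<b)
    (subst (λ lo → ∀ z → lo < z → z < 18 * k + 3 → ¬ G z) (sym g-1) (no-element-between (<⇒≤ (<-trans b<b+2 b+2<2a)) λ
      { (inj₁ refl) () _
      ; (inj₂ (inj₁ refl)) a<a _ → <-irrefl refl a<a
      ; (inj₂ (inj₂ (inj₁ refl))) _ b<b → <-irrefl refl b<b
      ; (inj₂ (inj₂ (inj₂ refl))) _ b+2<b → <-asym b<b+2 b+2<b }))

  g-3 : g 3 ≡ 18 * k + 5
  g-3 = g-next 2 (generator∈G (there (there (here refl)))) (subst (_< 18 * k + 5) (sym g-2) b<b+2)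
    (subst (λ lo → ∀ z → lo < z → z < 18 * k + 5 → ¬ G z) (sym g-2) (no-element-between (<⇒≤ b+2<2a) λ
      { (inj₁ refl) () _
      ; (inj₂ (inj₁ refl)) b<a _ → <-asym a<b b<a
      ; (inj₂ (inj₂ (inj₁ refl))) b<b _ → <-irrefl refl b<b
      ; (inj₂ (inj₂ (inj₂ refl))) _ b+2<b+2 → <-irrefl refl b+2<b+2 }))

  paper-form : ∀ s q r → (s + q) * (12 * k + 4) + q * ((12 * k + 4) / 2) ∸ 3 * q + 2 * r
                         ≡ s * (12 * k + 4) + q * (18 * k + 3) + 2 * r
  paper-form s q r = cong (_+ 2 * r) (begin
    (s + q) * (12 * k + 4) + q * ((12 * k + 4) / 2) ∸ 3 * q
      ≡⟨ cong (λ v → (s + q) * (12 * k + 4) + q * v ∸ 3 * q) half ⟩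
    (s + q) * (12 * k + 4) + q * (6 * k + 2) ∸ 3 * q
      ≡⟨ cong (_∸ 3 * q) (solve (k ∷ s ∷ q ∷ [])) ⟩
    s * (12 * k + 4) + q * (18 * k + 3) + 3 * q ∸ 3 * q
      ≡⟨ m+n∸n≡m (s * (12 * k + 4) + q * (18 * k + 3)) (3 * q) ⟩
    s * (12 * k + 4) + q * (18 * k + 3) ∎)
    where
    open ≡-Reasoning
    half : (12 * k + 4) / 2 ≡ 6 * k + 2
    half = trans (cong (_/ 2) (12 * k + 4 ≡ (6 * k + 2) * 2 ∋ solve (k ∷ []))) (m*n/n≡m (6 * k + 2) 2)


  G⇔paper-form : ∀ x → G x ⇔ (Σ ℕ λ s → Σ ℕ λ q → Σ ℕ λ r → r ≤ q ×
                               x ≡ (s + q) * (12 * k + 4) + q * ((12 * k + 4) / 2) ∸ 3 * q + 2 * r)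
  G⇔paper-form x = mk⇔
    (λ Gx → let s , q , r , r≤q , x≡ = G⇒representation Gx in s , q , r , r≤q , trans x≡ (sym (paper-form s q r)))
    (λ (s , q , r , r≤q , x≡) → representation⇒G (s , q , r , r≤q , trans x≡ (paper-form s q r)))

  G-is-3-permutation : IsPermutationNS 3 G
  G-is-3-permutation = record
    { numerical   = record { has-zero = gen-zero ; closed-+ = ⟨⟩-closed ; cofinite = conductor , G-beyond-conductor }
    ; g           = g
    ; enumeration = record { strictly-increasing = g-increasing ; members = g-member ; exhaustive = g-exhaustive }
    ; generated   = λ x → subst (λ L → G x ⇔ ⟨ L ⟩ x) (cong₂ _∷_ (sym g-1) (cong₂ _∷_ (sym g-2) (cong₂ _∷_ (sym g-3) refl)))
                                (mk⇔ id id)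
    ; residues    = blocks-permute-residues imbalance-small
    }

lemma4p12 : (k : ℕ) → 1 ≤ k →
    let a = 12 * k + 4
        S = a ∷ (18 * k + 3) ∷ (18 * k + 5) ∷ []
    in ((x : ℕ) → ⟨ S ⟩ x ⇔ (Σ ℕ λ s → Σ ℕ λ q → Σ ℕ λ r → r ≤ q ×
                               x ≡ (s + q) * a + q * (a / 2) ∸ 3 * q + 2 * r))
       × IsPermutationNS 3 ⟨ S ⟩
lemma4p12 k 1≤k = G⇔paper-form , G-is-3-permutation
  where open Semigroup k 1≤k
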